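{- Let $n\geq 3$ and let $k$ be an integer with $k\geq 2\left\lceil\log_3\left(\frac{n}{4}\right)\right\rceil+4$. Then $\chi_L(S_n(k))=\left\lceil\log_3\left(\frac{n}{4}\right)\right\rceil+3$.
   Context: For a simple connected graph $G=(V,E)$, a $k$-coloring is a map $c:V\to\{1,\dots,k\}$ with adjacent vertices receiving different colors; $c^{ -1}(i)$ denotes the $i$-th color class, and $d(u,S)=\min_{v\in S}d(u,v)$. The color code of $v$ is $r_c(v)=(d(v,c^{ -1}(1)),\dots,d(v,c^{ -1}(k)))$. The coloring $c$ is a locating coloring if distinct vertices have distinct color codes. The locating chromatic number $\chi_L(G)$ is the least $k$ such that $G$ has a locating $k$-coloring. $S_n(k)$ denotes the tree consisting of $n$ paths of length $k$ sharing one common endpoint (the hub), otherwise disjoint. -}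

module Defs where

open import Level using (Level; _⊔_)
open import Data.Nat using (ℕ; zero; suc; _≤_; _<_; _≥_; _+_; _*_; _^_)
open import Data.Fin using (Fin; toℕ)
open import Data.Sum using (_⊎_)
open import Data.Maybe using (Maybe; just; nothing)
open import Data.Product using (Σ; _×_; _,_; ∃-syntax)
open import Relation.Binary.PropositionalEquality using (_≡_; _≢_)

data Walk {V : Set} (Adj : V → V → Set) : V → V → ℕ → Set where
  here : ∀ {u} → Walk Adj u u 0
  step : ∀ {u v w m} → Adj u v → Walk Adj v w m → Walk Adj u w (suc m)

-- d(u, c⁻¹(i)) = d : some vertex of colour i is reachable from u by a walk
-- of length d, and no vertex of colour i is reachable by a shorter walk.
-- (Shortest walk length = graph distance.)  If the colour class is empty,
-- no d satisfies this (the distance is "infinite").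
DistToClass : {V : Set} (Adj : V → V → Set) {m : ℕ} (c : V → Fin m) →
              V → Fin m → ℕ → Set
DistToClass Adj c u i d =
  (Σ _ λ v → c v ≡ i × Walk Adj u v d) ×
  (∀ v d' → c v ≡ i → Walk Adj u v d' → d ≤ d')

-- Proper colouring with colours {1..m} (modelled as Fin m).
Proper : {V : Set} (Adj : V → V → Set) {m : ℕ} → (V → Fin m) → Set
Proper Adj c = ∀ u v → Adj u v → c u ≢ c v

Locating : {V : Set} (Adj : V → V → Set) {m : ℕ} → (V → Fin m) → Set
Locating Adj c =
  ∀ u v → u ≢ v →
  ∃[ i ] ∃[ d₁ ] ∃[ d₂ ]
    (DistToClass Adj c u i d₁ × DistToClass Adj c v i d₂ × d₁ ≢ d₂)

LocatingColoring : {V : Set} (Adj : V → V → Set) (m : ℕ) → Set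
LocatingColoring {V} Adj m = Σ (V → Fin m) λ c → Proper Adj c × Locating Adj c

LocChromNum : {V : Set} (Adj : V → V → Set) → ℕ → Set
LocChromNum Adj m = LocatingColoring Adj m × (∀ j → j < m → LocatingColoring Adj j → Data.Empty.⊥)
  where import Data.Empty

-- The tree S_n(k): hub = nothing; just (i , j) is the vertex at distance
-- j+1 from the hub on the i-th path (i : Fin n, j : Fin k).

SV : ℕ → ℕ → Set
SV n k = Maybe (Fin n × Fin k)

data SEdge (n k : ℕ) : SV n k → SV n k → Set where
  hub-leg : ∀ (i : Fin n) (j : Fin k) → toℕ j ≡ 0 →
            SEdge n k nothing (just (i , j))
  leg-leg : ∀ (i : Fin n) (j j' : Fin k) → toℕ j' ≡ suc (toℕ j) →
            SEdge n k (just (i , j)) (just (i , j'))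

SAdj : (n k : ℕ) → SV n k → SV n k → Set
SAdj n k u v = SEdge n k u v ⊎ SEdge n k v u

-- ⌈log₃(n/4)⌉ = t, for n ≥ 3 (so that t ≥ 0): t is the least natural
-- number with n/4 ≤ 3^t, i.e. n ≤ 4·3^t.
IsCeilLog3Quarter : ℕ → ℕ → Set
IsCeilLog3Quarter n t = n ≤ 4 * 3 ^ t × (∀ s → s < t → 4 * 3 ^ s < n)

-- In a locating colouring with m colours let h be the colour of the hub and a_i that of the
-- i-th hub neighbour u_i. The code of u_i is determined by a_i and its distances to the colour classes:
-- the distance to class h is 1, to a colour a_i′ ≠ a_i it is 1 or 2, and to any other colour it is within
-- one of the hub's distance. With p neighbour colours and q other colours this leaves p 2^(p-1) 3^q codes
-- for the n neighbours, and 9 p 2^p ≤ 8 3^p turns this into 9 n ≤ 4 3^(m-1), so m ≥ ⌈log₃(n/4)⌉ + 3.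
--
-- Colour the hub 0 and give the legs distinct labels (a, x, σ) ∈ 2 × 2 × 3^t, possible as
-- n ≤ 4 3^t: a leg alternates the tone a with the other tone (x) or with the hub colour (¬x), and for each
-- e < t with σ e < 2 the vertex at depth 3 + 2e + σ e gets the extra colour 3 + e, which fits as k ≥ 2t + 4.
-- Two vertices of equal colour are then told apart by the hub colour, by the tone missing from a leg, or by
-- an extra colour whose mark sits at a different depth (or is absent) on their legs.
module Submission where

open import Defs
open import Data.Nat using (ℕ; _≤_; _+_; _*_)

open import Algebra.Properties.CommutativeMonoid.Sum as ProductProperties using ()
open import Algebra.Properties.Semiring.Sum as SumProperties using ()
open import Data.Bool using (Bool; true; false; not; if_then_else_) renaming (_≟_ to _≟ᵇ_)
open import Data.Bool.Properties using (not-involutive; ¬-not)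
open import Data.Empty using (⊥-elim)
open import Data.Fin
  using (Fin; toℕ; fromℕ<; inject≤; combine; quotient; remainder; finToFun; funToFin)
  renaming (zero to fzero; suc to fsuc)
open import Data.Fin.Patterns using (0F; 1F; 2F; 3F)
open import Data.Fin.Properties
  using ( toℕ-fromℕ<; toℕ-injective; toℕ<n; toℕ-inject≤; toℕ-combine; combine-remQuot
        ; funToFin-finToFin; any?; ¬∀⟶∃¬; injective⇒≤ )
  renaming (_≟_ to _≟ᶠ_; suc-injective to fsuc-injective)
open import Data.List
  using (List; []; _∷_; length; concat; tabulate; filter; upTo; allFin; cartesianProduct; cartesianProductWith)
  renaming (map to mapᴸ; lookup to lookupᴸ)
open import Data.List.Extrema.Nat using (argmin; argmin-sel; f[argmin]≤f[⊤]; f[argmin]≤f[xs])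
open import Data.List.Membership.Propositional using (_∈_)
open import Data.List.Membership.Propositional.Properties
  using ( ∈-map⁺; ∈-cartesianProduct⁺; ∈-cartesianProductWith⁺; ∈-allFin; ∈-filter⁺; ∈-filter⁻
        ; ∈-concat⁺′; ∈-tabulate⁺; ∈-upTo⁺ )
open import Data.List.Properties using (length-++; length-map; length-upTo)
open import Data.List.Relation.Unary.All as All using ()
open import Data.List.Relation.Unary.Any using (here; there; index)
open import Data.List.Relation.Unary.Any.Properties using (lookup-index)
open import Data.Maybe using (just; nothing)
open import Data.Nat using (zero; suc; _<_; _∸_; _^_; _⊔_; z≤n; s≤s; ∣_-_∣; _≟_; _<?_)
open import Data.Nat.Properties
open import Data.Nat.Solver using (module +-*-Solver)
open import Data.Product using (_×_; _,_; proj₁; proj₂; ∃; ∃-syntax)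
open import Data.Sum using (_⊎_; inj₁; inj₂)
open import Data.Vec as Vec using (Vec)
open import Data.Vec.Properties using (lookup∘tabulate)
open import Function using (_∘_)
open import Relation.Binary using (tri<; tri≈; tri>)
open import Relation.Binary.PropositionalEquality
open import Relation.Nullary using (Dec; yes; no; ¬_; does)
open import Relation.Nullary.Decidable using (dec-true; dec-false; _×-dec_)

pattern hub = nothing
pattern leg i j = just (i , j)

_++ʷ_ : ∀ {V : Set} {Adj : V → V → Set} {u v w a b} → Walk Adj u v a → Walk Adj v w b → Walk Adj u w (a + b)
here ++ʷ q = q
step e p ++ʷ q = step e (p ++ʷ q)

walk-length-zero : ∀ {V : Set} {Adj : V → V → Set} {u v} → Walk Adj u v 0 → u ≡ v
walk-length-zero here = refl

module ClassDistance
  {V : Set} (Adj : V → V → Set) (dist : V → V → ℕ)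
  (walk⇒dist≤ : ∀ {u v L} → Walk Adj u v L → dist u v ≤ L)
  (geodesic : ∀ u v → Walk Adj u v (dist u v))
  (vertices : List V) (∈-vertices : ∀ v → v ∈ vertices)
  where

  dist-self : ∀ u → dist u u ≡ 0
  dist-self u = n≤0⇒n≡0 (walk⇒dist≤ here)

  dist≡0⇒≡ : ∀ {u v} → dist u v ≡ 0 → u ≡ v
  dist≡0⇒≡ {u} {v} eq = walk-length-zero (subst (Walk Adj u v) eq (geodesic u v))

  dist-triangle : ∀ u v w → dist u w ≤ dist u v + dist v w
  dist-triangle u v w = walk⇒dist≤ (geodesic u v ++ʷ geodesic v w)

  dist-adjacent : ∀ {u v} → Adj u v → ∀ w → dist u w ≤ suc (dist v w)
  dist-adjacent uv w = walk⇒dist≤ (step uv (geodesic _ w))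

  -- Junk value 0 for the empty list, so the distance to an empty colour class is 0.
  minDist : V → List V → ℕ
  minDist u [] = 0
  minDist u (w ∷ ws) = dist u (argmin (dist u) w ws)

  minDist-attained : ∀ u {xs z} → z ∈ xs → ∃[ y ] (y ∈ xs × minDist u xs ≡ dist u y)
  minDist-attained u {w ∷ ws} _ with argmin-sel (dist u) w ws
  ... | inj₁ eq = w , here refl , cong (dist u) eq
  ... | inj₂ y∈ws = argmin (dist u) w ws , there y∈ws , refl

  minDist-minimal : ∀ u {xs z} → z ∈ xs → minDist u xs ≤ dist u z
  minDist-minimal u {w ∷ ws} (here refl) = f[argmin]≤f[⊤] {f = dist u} w ws
  minDist-minimal u {w ∷ ws} (there z∈ws) = All.lookup (f[argmin]≤f[xs] {f = dist u} w ws) z∈ws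

  minDist-adjacent : ∀ {u v} → Adj u v → ∀ xs → minDist u xs ≤ suc (minDist v xs)
  minDist-adjacent uv [] = z≤n
  minDist-adjacent {u} {v} uv xs@(w ∷ _) with minDist-attained v {xs} (here refl)
  ... | y , y∈xs , eq = begin
    minDist u xs      ≤⟨ minDist-minimal u y∈xs ⟩
    dist u y          ≤⟨ dist-adjacent uv y ⟩
    suc (dist v y)    ≡⟨ cong suc (sym eq) ⟩
    suc (minDist v xs) ∎
    where open ≤-Reasoning

  module Colouring {m : ℕ} (c : V → Fin m) where

    colourClass : Fin m → List V
    colourClass b = filter (λ v → c v ≟ᶠ b) vertices

    ∈-colourClass : ∀ {v b} → c v ≡ b → v ∈ colourClass b
    ∈-colourClass cv = ∈-filter⁺ (λ v → c v ≟ᶠ _) (∈-vertices _) cv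

    distToClass : V → Fin m → ℕ
    distToClass u b = minDist u (colourClass b)

    distToClass≤dist : ∀ {u w b} → c w ≡ b → distToClass u b ≤ dist u w
    distToClass≤dist cw = minDist-minimal _ (∈-colourClass cw)

    distToClass-attained : ∀ {u w b} → c w ≡ b → ∃[ y ] (c y ≡ b × distToClass u b ≡ dist u y)
    distToClass-attained {u} cw with minDist-attained u (∈-colourClass cw)
    ... | y , y∈ , eq = y , proj₂ (∈-filter⁻ (λ v → c v ≟ᶠ _) {xs = vertices} y∈) , eq

    distToClass-isDistToClass : ∀ {u w b} → c w ≡ b → DistToClass Adj c u b (distToClass u b)
    distToClass-isDistToClass {u} cw with distToClass-attained {u} cw
    ... | y , cy , eq = (y , cy , subst (Walk Adj u y) (sym eq) (geodesic u y)) ,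
                        λ v d cv p → ≤-trans (distToClass≤dist cv) (walk⇒dist≤ p)

    DistToClass⇒≡distToClass : ∀ {u b d} → DistToClass Adj c u b d → d ≡ distToClass u b
    DistToClass⇒≡distToClass {u} ((w , cw , p) , minimal) with distToClass-attained {u} cw
    ... | y , cy , eq = ≤-antisym (minimal y _ cy (subst (Walk Adj u y) (sym eq) (geodesic u y)))
                                  (≤-trans (distToClass≤dist cw) (walk⇒dist≤ p))

    ≤distToClass : ∀ {u w b L} → c w ≡ b → (∀ z → c z ≡ b → L ≤ dist u z) → L ≤ distToClass u b
    ≤distToClass {u} cw bound with distToClass-attained {u} cw
    ... | y , cy , eq = ≤-trans (bound y cy) (≤-reflexive (sym eq))

    distToClass-own : ∀ u → distToClass u (c u) ≡ 0
    distToClass-own u = n≤0⇒n≡0 (≤-trans (distToClass≤dist refl) (≤-reflexive (dist-self u)))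

    distToClass≡0⇒ : ∀ {u w b} → c w ≡ b → distToClass u b ≡ 0 → c u ≡ b
    distToClass≡0⇒ {u} cw eq with distToClass-attained {u} cw
    ... | y , cy , eq′ = subst (λ z → c z ≡ _) (sym (dist≡0⇒≡ (trans (sym eq′) eq))) cy

    distToClass-positive : ∀ {u w b} → c w ≡ b → c u ≢ b → 1 ≤ distToClass u b
    distToClass-positive {u} {b = b} cw cu≢b with distToClass u b in eq
    ... | zero = ⊥-elim (cu≢b (distToClass≡0⇒ cw eq))
    ... | suc _ = s≤s z≤n

    distToClass-adjacent : ∀ {u v} → Adj u v → ∀ b → distToClass u b ≤ suc (distToClass v b)
    distToClass-adjacent uv b = minDist-adjacent uv (colourClass b)

    Distinguished : V → V → Set
    Distinguished u v = ∃[ b ] ∃[ d₁ ] ∃[ d₂ ]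
      (DistToClass Adj c u b d₁ × DistToClass Adj c v b d₂ × d₁ ≢ d₂)

    distinguished-sym : ∀ {u v} → Distinguished u v → Distinguished v u
    distinguished-sym (b , d₁ , d₂ , D₁ , D₂ , d₁≢d₂) = b , d₂ , d₁ , D₂ , D₁ , λ eq → d₁≢d₂ (sym eq)

    distinguished⇒distToClass≢ : ∀ {u v} → Distinguished u v → ∃[ b ] (distToClass u b ≢ distToClass v b)
    distinguished⇒distToClass≢ (b , d₁ , d₂ , D₁ , D₂ , d₁≢d₂) =
      b , λ eq → d₁≢d₂ (trans (DistToClass⇒≡distToClass D₁) (trans eq (sym (DistToClass⇒≡distToClass D₂))))

    distinguished-by-distToClass : ∀ {u v w b} → c w ≡ b → distToClass u b ≢ distToClass v b → Distinguished u v
    distinguished-by-distToClass {u} {v} cw differ =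
      _ , _ , _ , distToClass-isDistToClass {u} cw , distToClass-isDistToClass {v} cw , differ

    distinguished-by-gap : ∀ {u v w b U L} → c w ≡ b → dist u w ≤ U →
      (∀ z → c z ≡ b → L ≤ dist v z) → U < L → Distinguished u v
    distinguished-by-gap cw du far U<L =
      distinguished-by-distToClass cw
        (<⇒≢ (≤-<-trans (≤-trans (distToClass≤dist cw) du) (<-≤-trans U<L (≤distToClass cw far))))

    distinguished-by-colour : ∀ {u v} → c u ≢ c v → Distinguished u v
    distinguished-by-colour {u} cu≢cv = distinguished-by-distToClass {w = u} refl λ eq →
      <⇒≢ (distToClass-positive refl (cu≢cv ∘ sym)) (trans (sym (distToClass-own u)) eq)

∣suc-∣≤suc∣-∣ : ∀ a b → ∣ suc a - b ∣ ≤ suc ∣ a - b ∣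
∣suc-∣≤suc∣-∣ zero zero = s≤s z≤n
∣suc-∣≤suc∣-∣ zero (suc b) = m≤n⇒m≤1+n (n≤1+n b)
∣suc-∣≤suc∣-∣ (suc a) zero = ≤-refl
∣suc-∣≤suc∣-∣ (suc a) (suc b) = ∣suc-∣≤suc∣-∣ a b

∣-∣≤suc∣suc-∣ : ∀ a b → ∣ a - b ∣ ≤ suc ∣ suc a - b ∣
∣-∣≤suc∣suc-∣ zero zero = z≤n
∣-∣≤suc∣suc-∣ zero (suc b) = ≤-refl
∣-∣≤suc∣suc-∣ (suc a) zero = m≤n⇒m≤1+n (n≤1+n (suc a))
∣-∣≤suc∣suc-∣ (suc a) (suc b) = ∣-∣≤suc∣suc-∣ a b

module Star (n k : ℕ) where

  V : Set
  V = SV n k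

  Adj : V → V → Set
  Adj = SAdj n k

  legDist : {i i′ : Fin n} → Dec (i ≡ i′) → ℕ → ℕ → ℕ
  legDist (yes _) p p′ = ∣ p - p′ ∣
  legDist (no _) p p′ = suc p + suc p′

  dist : V → V → ℕ
  dist hub hub = 0
  dist hub (leg i j) = suc (toℕ j)
  dist (leg i j) hub = suc (toℕ j)
  dist (leg i j) (leg i′ j′) = legDist (i ≟ᶠ i′) (toℕ j) (toℕ j′)

  dist-sameLeg : ∀ i (j j′ : Fin k) → dist (leg i j) (leg i j′) ≡ ∣ toℕ j - toℕ j′ ∣
  dist-sameLeg i j j′ with i ≟ᶠ i
  ... | yes _ = refl
  ... | no i≢i = ⊥-elim (i≢i refl)

  dist-otherLeg : ∀ {i i′} → i ≢ i′ → (j j′ : Fin k) →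
    dist (leg i j) (leg i′ j′) ≡ suc (toℕ j) + suc (toℕ j′)
  dist-otherLeg {i} {i′} i≢i′ j j′ with i ≟ᶠ i′
  ... | yes i≡i′ = ⊥-elim (i≢i′ i≡i′)
  ... | no _ = refl

  dist-edge : ∀ {x y} → SEdge n k x y → ∀ v → dist x v ≤ suc (dist y v) × dist y v ≤ suc (dist x v)
  dist-edge (hub-leg i j j≡0) hub rewrite j≡0 = z≤n , s≤s z≤n
  dist-edge (hub-leg i j j≡0) (leg i′ j′) with i ≟ᶠ i′
  ... | yes refl rewrite j≡0 = ≤-refl , m≤n⇒m≤1+n (n≤1+n _)
  ... | no _ rewrite j≡0 = m≤n⇒m≤1+n (n≤1+n _) , ≤-refl
  dist-edge (leg-leg i j j′ j′≡1+j) hub rewrite j′≡1+j = m≤n⇒m≤1+n (n≤1+n _) , ≤-refl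
  dist-edge (leg-leg i j j′ j′≡1+j) (leg i′ l) with i ≟ᶠ i′
  ... | yes refl rewrite j′≡1+j = ∣-∣≤suc∣suc-∣ (toℕ j) (toℕ l) , ∣suc-∣≤suc∣-∣ (toℕ j) (toℕ l)
  ... | no _ rewrite j′≡1+j = m≤n⇒m≤1+n (n≤1+n _) , ≤-refl

  walk⇒dist≤ : ∀ {u v L} → Walk Adj u v L → dist u v ≤ L
  walk⇒dist≤ {u} here = ≤-reflexive (dist-self u)
    where
      dist-self : ∀ u → dist u u ≡ 0
      dist-self hub = refl
      dist-self (leg i j) = trans (dist-sameLeg i j j) (∣n-n∣≡0 (toℕ j))
  walk⇒dist≤ {v = v} (step (inj₁ e) p) = ≤-trans (proj₁ (dist-edge e v)) (s≤s (walk⇒dist≤ p))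
  walk⇒dist≤ {v = v} (step (inj₂ e) p) = ≤-trans (proj₂ (dist-edge e v)) (s≤s (walk⇒dist≤ p))

  Adj-sym : ∀ {x y} → Adj x y → Adj y x
  Adj-sym (inj₁ e) = inj₂ e
  Adj-sym (inj₂ e) = inj₁ e

  reverse : ∀ {u v L} → Walk Adj u v L → Walk Adj v u L
  reverse here = here
  reverse {L = suc L} (step e p) = subst (Walk Adj _ _) (+-comm L 1) (reverse p ++ʷ step (Adj-sym e) here)

  descend : ∀ i d (j : Fin k) → toℕ j ≡ d → Walk Adj (leg i j) hub (suc d)
  descend i zero j j≡0 = step (inj₂ (hub-leg i j j≡0)) here
  descend i (suc d) j j≡1+d =
    step (inj₂ (leg-leg i j′ j (trans j≡1+d (cong suc (sym (toℕ-fromℕ< d<k))))))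
         (descend i d j′ (toℕ-fromℕ< d<k))
    where
      d<k : d < k
      d<k = <-trans (n<1+n d) (subst (_< k) j≡1+d (toℕ<n j))
      j′ : Fin k
      j′ = fromℕ< d<k

  ascend : ∀ i d (j j′ : Fin k) → toℕ j′ ≡ toℕ j + d → Walk Adj (leg i j) (leg i j′) d
  ascend i zero j j′ j′≡j+0 =
    subst (λ x → Walk Adj (leg i j) (leg i x) 0) (toℕ-injective (sym (trans j′≡j+0 (+-identityʳ (toℕ j))))) here
  ascend i (suc d) j j′ j′≡j+1+d =
    step (inj₁ (leg-leg i j j″ (toℕ-fromℕ< 1+j<k)))
         (ascend i d j″ j′ (trans j′≡j+1+d (trans (+-suc (toℕ j) d) (cong (_+ d) (sym (toℕ-fromℕ< 1+j<k))))))
    where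
      1+j<k : suc (toℕ j) < k
      1+j<k = ≤-<-trans (s≤s (m≤m+n (toℕ j) d))
                (subst (_< k) (trans j′≡j+1+d (+-suc (toℕ j) d)) (toℕ<n j′))
      j″ : Fin k
      j″ = fromℕ< 1+j<k

  alongLeg : ∀ i (j j′ : Fin k) → toℕ j ≤ toℕ j′ → Walk Adj (leg i j) (leg i j′) ∣ toℕ j - toℕ j′ ∣
  alongLeg i j j′ j≤j′ =
    subst (Walk Adj _ _) (sym (m≤n⇒∣m-n∣≡n∸m j≤j′)) (ascend i _ j j′ (sym (m+[n∸m]≡n j≤j′)))

  geodesic : ∀ u v → Walk Adj u v (dist u v)
  geodesic hub hub = here
  geodesic hub (leg i j) = reverse (descend i _ j refl)
  geodesic (leg i j) hub = descend i _ j refl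
  geodesic (leg i j) (leg i′ j′) with i ≟ᶠ i′
  ... | no _ = descend i _ j refl ++ʷ reverse (descend i′ _ j′ refl)
  ... | yes refl with ≤-total (toℕ j) (toℕ j′)
  ...   | inj₁ j≤j′ = alongLeg i j j′ j≤j′
  ...   | inj₂ j′≤j = subst (Walk Adj _ _) (∣-∣-comm (toℕ j′) (toℕ j)) (reverse (alongLeg i j′ j j′≤j))

  vertices : List V
  vertices = hub ∷ mapᴸ just (cartesianProduct (allFin n) (allFin k))

  ∈-vertices : ∀ v → v ∈ vertices
  ∈-vertices hub = here refl
  ∈-vertices (leg i j) = there (∈-map⁺ just (∈-cartesianProduct⁺ (∈-allFin i) (∈-allFin j)))

  open ClassDistance Adj dist walk⇒dist≤ geodesic vertices ∈-vertices public

open SumProperties +-*-semiring using (sum; sum-cong-≗; ∑-distrib-+; *-distribˡ-sum; *-distribʳ-sum; sum-replicate-zero)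
open ProductProperties *-1-commutativeMonoid
  using () renaming (sum to product; ∑-distrib-+ to product-distrib-*; sum-cong-≗ to product-cong-≗)

sum-indicator : ∀ {m} (h : Fin m) → sum (λ b → if does (b ≟ᶠ h) then 1 else 0) ≡ 1
sum-indicator {suc m} fzero = cong suc (sum-replicate-zero m)
sum-indicator {suc m} (fsuc h) = sum-indicator h

sum-ones : ∀ m → sum {m} (λ _ → 1) ≡ m
sum-ones zero = refl
sum-ones (suc m) = cong suc (sum-ones m)

product-^ : ∀ x {m} (e : Fin m → ℕ) → product (λ b → x ^ e b) ≡ x ^ sum e
product-^ x {zero} e = refl
product-^ x {suc m} e = trans (cong (x ^ e fzero *_) (product-^ x (e ∘ fsuc))) (sym (^-distribˡ-+-* x (e fzero) _))

2*product-doubled : ∀ {m} (f f′ : Fin m → ℕ) a → f a ≡ 1 → f′ a ≡ 2 →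
  (∀ b → b ≢ a → f b ≡ f′ b) → 2 * product f ≡ product f′
2*product-doubled {suc m} f f′ fzero fa≡1 f′a≡2 agree = begin
  2 * (f fzero * product (f ∘ fsuc))   ≡⟨ cong (λ x → 2 * (x * product (f ∘ fsuc))) fa≡1 ⟩
  2 * (1 * product (f ∘ fsuc))         ≡⟨ cong (2 *_) (*-identityˡ (product (f ∘ fsuc))) ⟩
  2 * product (f ∘ fsuc)               ≡⟨ cong₂ _*_ (sym f′a≡2) (product-cong-≗ (λ b → agree (fsuc b) λ ())) ⟩
  f′ fzero * product (f′ ∘ fsuc)       ∎
  where open ≡-Reasoning
2*product-doubled {suc m} f f′ (fsuc a) fa≡1 f′a≡2 agree = begin
  2 * (f fzero * product (f ∘ fsuc))   ≡⟨ solve 2 (λ x y → con 2 :* (x :* y) := x :* (con 2 :* y)) refl (f fzero) _ ⟩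
  f fzero * (2 * product (f ∘ fsuc))   ≡⟨ cong₂ _*_ (agree fzero λ ()) 2*tail ⟩
  f′ fzero * product (f′ ∘ fsuc)       ∎
  where
    open ≡-Reasoning
    open +-*-Solver
    2*tail : 2 * product (f ∘ fsuc) ≡ product (f′ ∘ fsuc)
    2*tail = 2*product-doubled (f ∘ fsuc) (f′ ∘ fsuc) a fa≡1 f′a≡2 λ b b≢a → agree (fsuc b) (b≢a ∘ fsuc-injective)

length-concat-tabulate : ∀ {A : Set} {m} (f : Fin m → List A) → length (concat (tabulate f)) ≡ sum (length ∘ f)
length-concat-tabulate {m = zero} f = refl
length-concat-tabulate {m = suc m} f =
  trans (length-++ (f fzero)) (cong (length (f fzero) +_) (length-concat-tabulate (f ∘ fsuc)))

∈-concat-tabulate : ∀ {A : Set} {m} (f : Fin m → List A) b {x} → x ∈ f b → x ∈ concat (tabulate f)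
∈-concat-tabulate f b x∈ = ∈-concat⁺′ x∈ (∈-tabulate⁺ {f = f} b)

injective⇒≤length : ∀ {A : Set} {n} {xs : List A} (f : Fin n → A) →
  (∀ {i i′} → f i ≡ f i′ → i ≡ i′) → (∀ i → f i ∈ xs) → n ≤ length xs
injective⇒≤length {xs = xs} f f-injective f∈xs =
  injective⇒≤ λ {i} {i′} eq → f-injective (begin
  f i                            ≡⟨ lookup-index (f∈xs i) ⟩
  lookupᴸ xs (index (f∈xs i))    ≡⟨ cong (lookupᴸ xs) eq ⟩
  lookupᴸ xs (index (f∈xs i′))   ≡⟨ lookup-index (f∈xs i′) ⟨
  f i′                           ∎)
  where open ≡-Reasoning

length-cartesianProductWith : ∀ {A B C : Set} (f : A → B → C) xs ys →
  length (cartesianProductWith f xs ys) ≡ length xs * length ys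
length-cartesianProductWith f [] ys = refl
length-cartesianProductWith f (x ∷ xs) ys =
  trans (length-++ (mapᴸ (f x) ys)) (cong₂ _+_ (length-map (f x) ys) (length-cartesianProductWith f xs ys))

boundedVecs : ∀ {m} → (Fin m → ℕ) → List (Vec ℕ m)
boundedVecs {zero} g = Vec.[] ∷ []
boundedVecs {suc m} g = cartesianProductWith Vec._∷_ (upTo (g fzero)) (boundedVecs (g ∘ fsuc))

length-boundedVecs : ∀ {m} (g : Fin m → ℕ) → length (boundedVecs g) ≡ product g
length-boundedVecs {zero} g = refl
length-boundedVecs {suc m} g = begin
  length (boundedVecs g)
    ≡⟨ length-cartesianProductWith Vec._∷_ (upTo (g fzero)) _ ⟩
  length (upTo (g fzero)) * length (boundedVecs (g ∘ fsuc))
    ≡⟨ cong₂ _*_ (length-upTo (g fzero)) (length-boundedVecs (g ∘ fsuc)) ⟩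
  g fzero * product (g ∘ fsuc)
    ∎
  where open ≡-Reasoning

∈-boundedVecs : ∀ {m} (g : Fin m → ℕ) (v : Vec ℕ m) → (∀ b → Vec.lookup v b < g b) → v ∈ boundedVecs g
∈-boundedVecs {zero} g Vec.[] _ = here refl
∈-boundedVecs {suc m} g (x Vec.∷ v) bounded =
  ∈-cartesianProductWith⁺ Vec._∷_ (∈-upTo⁺ (bounded fzero)) (∈-boundedVecs (g ∘ fsuc) v (bounded ∘ fsuc))

9*p*2^p≤8*3^p : ∀ p → 9 * p * 2 ^ p ≤ 8 * 3 ^ p
9*p*2^p≤8*3^p 0 = z≤n
9*p*2^p≤8*3^p 1 = m≤m+n 18 6
9*p*2^p≤8*3^p 2 = ≤-refl
9*p*2^p≤8*3^p (suc p@(suc (suc _))) = begin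
  9 * suc p * 2 ^ suc p
    ≡⟨ solve 2 (λ p x → con 9 :* (con 1 :+ p) :* (con 2 :* x) := (con 18 :* p :+ con 18) :* x) refl p (2 ^ p) ⟩
  (18 * p + 18) * 2 ^ p
    ≤⟨ *-monoˡ-≤ (2 ^ p) (+-monoʳ-≤ (18 * p) (*-monoʳ-≤ 9 p≥2)) ⟩
  (18 * p + 9 * p) * 2 ^ p
    ≡⟨ solve 2 (λ p x → (con 18 :* p :+ con 9 :* p) :* x := con 3 :* (con 9 :* p :* x)) refl p (2 ^ p) ⟩
  3 * (9 * p * 2 ^ p)
    ≤⟨ *-monoʳ-≤ 3 (9*p*2^p≤8*3^p p) ⟩
  3 * (8 * 3 ^ p)
    ≡⟨ solve 1 (λ x → con 3 :* (con 8 :* x) := con 8 :* (con 3 :* x)) refl (3 ^ p) ⟩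
  8 * 3 ^ suc p
    ∎
  where
    open ≤-Reasoning
    open +-*-Solver
    p≥2 : 2 ≤ p
    p≥2 = s≤s (s≤s z≤n)

x+1∸y<3 : ∀ x y → x ≤ suc y → x + 1 ∸ y < 3
x+1∸y<3 x y x≤1+y = s≤s (begin
  x + 1 ∸ y   ≤⟨ ∸-monoˡ-≤ y (≤-trans (≤-reflexive (+-comm x 1)) (s≤s x≤1+y)) ⟩
  2 + y ∸ y   ≡⟨ m+n∸n≡m 2 y ⟩
  2           ∎)
  where open ≤-Reasoning

x+1∸y+y∸1≡x : ∀ x y → y ≤ suc x → x + 1 ∸ y + y ∸ 1 ≡ x
x+1∸y+y∸1≡x x y y≤1+x = begin
  x + 1 ∸ y + y ∸ 1  ≡⟨ cong (_∸ 1) (m∸n+n≡m (≤-trans y≤1+x (≤-reflexive (+-comm 1 x)))) ⟩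
  x + 1 ∸ 1          ≡⟨ m+n∸n≡m x 1 ⟩
  x                  ∎
  where open ≡-Reasoning

module LowerBound (n k : ℕ) {m : ℕ} (c : SV n (suc k) → Fin m)
  (proper : Proper (SAdj n (suc k)) c) (locating : Locating (SAdj n (suc k)) c) where

  open Star n (suc k)
  open Colouring c

  h : Fin m
  h = c hub

  u : Fin n → V
  u i = leg i fzero

  a : Fin n → Fin m
  a i = c (u i)

  hub~u : ∀ i → Adj hub (u i)
  hub~u i = inj₁ (hub-leg i fzero refl)

  h≢a : ∀ i → h ≢ a i
  h≢a i = proper hub (u i) (hub~u i)

  IsNeighbourColour : Fin m → Set
  IsNeighbourColour b = ∃[ i ] (a i ≡ b)

  data Kind (b : Fin m) : Set where
    hubColour : b ≡ h → Kind b
    neighbourColour : IsNeighbourColour b → Kind b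
    otherColour : b ≢ h → ¬ IsNeighbourColour b → Kind b

  kind : ∀ b → Kind b
  kind b with b ≟ᶠ h | any? (λ i → a i ≟ᶠ b)
  ... | yes b≡h | _ = hubColour b≡h
  ... | no _ | yes nb = neighbourColour nb
  ... | no b≢h | no ¬nb = otherColour b≢h ¬nb

  weight : ∀ {b} → Kind b → ℕ
  weight (hubColour _) = 1
  weight (neighbourColour _) = 2
  weight (otherColour _ _) = 3

  #neighbour #other : ∀ {b} → Kind b → ℕ
  #neighbour (neighbourColour _) = 1
  #neighbour _ = 0
  #other (otherColour _ _) = 1
  #other _ = 0

  w : Fin m → ℕ
  w b = weight (kind b)

  g : Fin m → Fin m → ℕ
  g a′ b = if does (b ≟ᶠ a′) then 1 else w b

  -- The distance x from u i to class b is 1 for the hub colour, 0 (if b = a i) or 1 to 2 for the other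
  -- neighbour colours, and within one of the hub's distance otherwise; entry shifts it into the range
  -- below g (a i) b, and decodeEntry inverts the shift.
  entry : ∀ {b} → Kind b → ℕ → ℕ
  entry (hubColour _) x = 0
  entry (neighbourColour _) x = x ∸ 1
  entry {b} (otherColour _ _) x = x + 1 ∸ distToClass hub b

  decodeEntry : ∀ {b} → Kind b → Fin m → ℕ → ℕ
  decodeEntry (hubColour _) a′ e = 1
  decodeEntry {b} (neighbourColour _) a′ e = if does (b ≟ᶠ a′) then 0 else suc e
  decodeEntry {b} (otherColour _ _) a′ e = e + distToClass hub b ∸ 1

  τ : Fin n → Fin m → ℕ
  τ i b = entry (kind b) (distToClass (u i) b)

  distToClass-hubColour : ∀ i → distToClass (u i) h ≡ 1
  distToClass-hubColour i =
    ≤-antisym (distToClass≤dist {w = hub} refl) (distToClass-positive {w = hub} refl (h≢a i ∘ sym))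

  distToClass-neighbourColour : ∀ i {i′} → a i ≢ a i′ →
    1 ≤ distToClass (u i) (a i′) × distToClass (u i) (a i′) ≤ 2
  distToClass-neighbourColour i {i′} ai≢ai′ =
    distToClass-positive refl ai≢ai′ ,
    ≤-trans (distToClass≤dist refl) (≤-reflexive (dist-otherLeg {i} {i′} (λ { refl → ai≢ai′ refl }) fzero fzero))

  entry-correct : ∀ i b → τ i b < g (a i) b × distToClass (u i) b ≡ decodeEntry (kind b) (a i) (τ i b)
  entry-correct i b with kind b | b ≟ᶠ a i
  ... | hubColour refl | yes h≡ai = ⊥-elim (h≢a i h≡ai)
  ... | hubColour refl | no _ = s≤s z≤n , distToClass-hubColour i
  ... | neighbourColour _ | yes refl rewrite distToClass-own (u i) | dec-true (a i ≟ᶠ a i) refl = s≤s z≤n , refl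
  ... | neighbourColour (i′ , refl) | no b≢ai rewrite dec-false (a i′ ≟ᶠ a i) b≢ai =
    s≤s (∸-monoˡ-≤ 1 x≤2) , sym (trans (+-comm 1 (x ∸ 1)) (m∸n+n≡m 1≤x))
    where
      x = distToClass (u i) b
      1≤x = proj₁ (distToClass-neighbourColour i (b≢ai ∘ sym))
      x≤2 = proj₂ (distToClass-neighbourColour i (b≢ai ∘ sym))
  ... | otherColour _ ¬nb | yes refl = ⊥-elim (¬nb (i , refl))
  ... | otherColour _ _ | no _ =
    x+1∸y<3 x y (distToClass-adjacent (Adj-sym (hub~u i)) b) ,
    sym (x+1∸y+y∸1≡x x y (distToClass-adjacent (hub~u i) b))
    where
      x = distToClass (u i) b
      y = distToClass hub b

  Code : Set
  Code = Fin m × Vec ℕ m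

  code : Fin n → Code
  code i = a i , Vec.tabulate (τ i)

  code-injective : ∀ {i i′} → code i ≡ code i′ → i ≡ i′
  code-injective {i} {i′} eq with i ≟ᶠ i′
  ... | yes i≡i′ = i≡i′
  ... | no i≢i′ with distinguished⇒distToClass≢ (locating (u i) (u i′) λ { refl → i≢i′ refl })
  ...   | b , differ = ⊥-elim (differ (begin
    distToClass (u i) b                       ≡⟨ proj₂ (entry-correct i b) ⟩
    decodeEntry (kind b) (a i) (τ i b)        ≡⟨ cong₂ (decodeEntry (kind b)) (cong proj₁ eq) τ≡τ′ ⟩
    decodeEntry (kind b) (a i′) (τ i′ b)      ≡⟨ proj₂ (entry-correct i′ b) ⟨
    distToClass (u i′) b                      ∎))
    where
      open ≡-Reasoning
      τ≡τ′ : τ i b ≡ τ i′ b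
      τ≡τ′ = begin
        τ i b                                  ≡⟨ lookup∘tabulate (τ i) b ⟨
        Vec.lookup (Vec.tabulate (τ i)) b      ≡⟨ cong (λ v → Vec.lookup (proj₂ v) b) eq ⟩
        Vec.lookup (Vec.tabulate (τ i′)) b     ≡⟨ lookup∘tabulate (τ i′) b ⟩
        τ i′ b                                 ∎

  candidatesOf : ∀ a′ → Kind a′ → List Code
  candidatesOf a′ (neighbourColour _) = mapᴸ (a′ ,_) (boundedVecs (g a′))
  candidatesOf a′ _ = []

  candidates : List Code
  candidates = concat (tabulate λ a′ → candidatesOf a′ (kind a′))

  code∈candidates : ∀ i → code i ∈ candidates
  code∈candidates i = ∈-concat-tabulate _ (a i) (code∈ (kind (a i)))
    where
      code∈ : (κ : Kind (a i)) → code i ∈ candidatesOf (a i) κ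
      code∈ (hubColour ai≡h) = ⊥-elim (h≢a i (sym ai≡h))
      code∈ (neighbourColour _) = ∈-map⁺ (a i ,_) (∈-boundedVecs (g (a i)) _ bounded)
        where
          bounded : ∀ b → Vec.lookup (Vec.tabulate (τ i)) b < g (a i) b
          bounded b rewrite lookup∘tabulate (τ i) b = proj₁ (entry-correct i b)
      code∈ (otherColour _ ¬nb) = ⊥-elim (¬nb (i , refl))

  n≤#candidates : n ≤ length candidates
  n≤#candidates = injective⇒≤length code code-injective code∈candidates

  #neighbours #others : ℕ
  #neighbours = sum (λ b → #neighbour (kind b))
  #others = sum (λ b → #other (kind b))

  product-weights : product w ≡ 2 ^ #neighbours * 3 ^ #others
  product-weights = begin
    product w
      ≡⟨ product-cong-≗ weight≡ ⟩
    product (λ b → 2 ^ #neighbour (kind b) * 3 ^ #other (kind b))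
      ≡⟨ product-distrib-* (λ b → 2 ^ #neighbour (kind b)) (λ b → 3 ^ #other (kind b)) ⟩
    product (λ b → 2 ^ #neighbour (kind b)) * product (λ b → 3 ^ #other (kind b))
      ≡⟨ cong₂ _*_ (product-^ 2 (λ b → #neighbour (kind b))) (product-^ 3 (λ b → #other (kind b))) ⟩
    2 ^ #neighbours * 3 ^ #others
      ∎
    where
      open ≡-Reasoning
      weight≡ : ∀ b → w b ≡ 2 ^ #neighbour (kind b) * 3 ^ #other (kind b)
      weight≡ b with kind b
      ... | hubColour _ = refl
      ... | neighbourColour _ = refl
      ... | otherColour _ _ = refl

  weight-neighbourColour : ∀ {b} → IsNeighbourColour b → w b ≡ 2
  weight-neighbourColour {b} (i , refl) with kind b
  ... | hubColour ai≡h = ⊥-elim (h≢a i (sym ai≡h))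
  ... | neighbourColour _ = refl
  ... | otherColour _ ¬nb = ⊥-elim (¬nb (i , refl))

  2*#candidatesOf : ∀ a′ → 2 * length (candidatesOf a′ (kind a′)) ≡ #neighbour (kind a′) * product w
  2*#candidatesOf a′ with kind a′
  ... | hubColour _ = refl
  ... | otherColour _ _ = refl
  ... | neighbourColour nb = begin
    2 * length (mapᴸ (a′ ,_) (boundedVecs (g a′)))
      ≡⟨ cong (2 *_) (trans (length-map (a′ ,_) (boundedVecs (g a′))) (length-boundedVecs (g a′))) ⟩
    2 * product (g a′)
      ≡⟨ 2*product-doubled (g a′) w a′ g-diagonal (weight-neighbourColour nb) g≡w ⟩
    product w
      ≡⟨ *-identityˡ (product w) ⟨
    1 * product w
      ∎
    where
      open ≡-Reasoning
      g-diagonal : g a′ a′ ≡ 1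
      g-diagonal rewrite dec-true (a′ ≟ᶠ a′) refl = refl
      g≡w : ∀ b → b ≢ a′ → g a′ b ≡ w b
      g≡w b b≢a′ rewrite dec-false (b ≟ᶠ a′) b≢a′ = refl

  2*#candidates : 2 * length candidates ≡ #neighbours * product w
  2*#candidates = begin
    2 * length candidates
      ≡⟨ cong (2 *_) (length-concat-tabulate (λ a′ → candidatesOf a′ (kind a′))) ⟩
    2 * sum (λ a′ → length (candidatesOf a′ (kind a′)))
      ≡⟨ *-distribˡ-sum 2 (λ a′ → length (candidatesOf a′ (kind a′))) ⟩
    sum (λ a′ → 2 * length (candidatesOf a′ (kind a′)))
      ≡⟨ sum-cong-≗ 2*#candidatesOf ⟩
    sum (λ a′ → #neighbour (kind a′) * product w)
      ≡⟨ *-distribʳ-sum (product w) (λ a′ → #neighbour (kind a′)) ⟨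
    #neighbours * product w
      ∎
    where open ≡-Reasoning

  colours-partitioned : suc (#neighbours + #others) ≡ m
  colours-partitioned = begin
    1 + #neighbours + #others
      ≡⟨ cong (λ x → x + #neighbours + #others) (sum-indicator h) ⟨
    sum isHub + #neighbours + #others
      ≡⟨ cong (_+ #others) (∑-distrib-+ isHub (λ b → #neighbour (kind b))) ⟨
    sum (λ b → isHub b + #neighbour (kind b)) + #others
      ≡⟨ ∑-distrib-+ (λ b → isHub b + #neighbour (kind b)) (λ b → #other (kind b)) ⟨
    sum (λ b → isHub b + #neighbour (kind b) + #other (kind b))
      ≡⟨ sum-cong-≗ {m} partition ⟩
    sum {m} (λ _ → 1)
      ≡⟨ sum-ones m ⟩
    m
      ∎
    where
      open ≡-Reasoning
      isHub : Fin m → ℕ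
      isHub b = if does (b ≟ᶠ h) then 1 else 0
      partition : ∀ b → isHub b + #neighbour (kind b) + #other (kind b) ≡ 1
      partition b with kind b
      ... | hubColour b≡h rewrite dec-true (b ≟ᶠ h) b≡h = refl
      ... | neighbourColour (i , refl) rewrite dec-false (a i ≟ᶠ h) (h≢a i ∘ sym) = refl
      ... | otherColour b≢h _ rewrite dec-false (b ≟ᶠ h) b≢h = refl

  9*n≤4*3^[m∸1] : 9 * n ≤ 4 * 3 ^ (m ∸ 1)
  9*n≤4*3^[m∸1] rewrite sym colours-partitioned = *-cancelˡ-≤ 2 (begin
    2 * (9 * n)                    ≡⟨ solve 1 (λ x → con 2 :* (con 9 :* x) := con 9 :* (con 2 :* x)) refl n ⟩
    9 * (2 * n)                    ≤⟨ *-monoʳ-≤ 9 (*-monoʳ-≤ 2 n≤#candidates) ⟩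
    9 * (2 * length candidates)    ≡⟨ cong (9 *_) (trans 2*#candidates (cong (p *_) product-weights)) ⟩
    9 * (p * (2 ^ p * 3 ^ q))      ≡⟨ solve 3 (λ p x y → con 9 :* (p :* (x :* y)) := con 9 :* p :* x :* y)
                                              refl p (2 ^ p) (3 ^ q) ⟩
    9 * p * 2 ^ p * 3 ^ q          ≤⟨ *-monoˡ-≤ (3 ^ q) (9*p*2^p≤8*3^p p) ⟩
    8 * 3 ^ p * 3 ^ q              ≡⟨ solve 2 (λ x y → con 8 :* x :* y := con 2 :* (con 4 :* (x :* y))) refl (3 ^ p) (3 ^ q) ⟩
    2 * (4 * (3 ^ p * 3 ^ q))      ≡⟨ cong (λ x → 2 * (4 * x)) (^-distribˡ-+-* 3 p q) ⟨
    2 * (4 * 3 ^ (p + q))          ∎)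
    where
      open ≤-Reasoning
      open +-*-Solver
      p = #neighbours
      q = #others

locatingColouring-bound : ∀ n k m → LocatingColoring (SAdj n (suc k)) m → 9 * n ≤ 4 * 3 ^ (m ∸ 1)
locatingColouring-bound n k m (c , proper , locating) = LowerBound.9*n≤4*3^[m∸1] n k c proper locating

2*+<2*+ : ∀ {a b x y} → a < b → x < 2 → 2 * a + x < 2 * b + y
2*+<2*+ {a} {b} {x} {y} a<b x<2 = begin-strict
  2 * a + x        <⟨ +-monoʳ-< (2 * a) x<2 ⟩
  2 * a + 2        ≡⟨ +-comm (2 * a) 2 ⟩
  2 + 2 * a        ≡⟨ *-suc 2 a ⟨
  2 * suc a        ≤⟨ *-monoʳ-≤ 2 a<b ⟩
  2 * b            ≤⟨ m≤m+n (2 * b) y ⟩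
  2 * b + y        ∎
  where open ≤-Reasoning

2*+-injective : ∀ {a b x y} → x < 2 → y < 2 → 2 * a + x ≡ 2 * b + y → a ≡ b × x ≡ y
2*+-injective {a} {b} x<2 y<2 eq with <-cmp a b
... | tri< a<b _ _ = ⊥-elim (<⇒≢ (2*+<2*+ a<b x<2) eq)
... | tri> _ _ b<a = ⊥-elim (<⇒≢ (2*+<2*+ b<a y<2) (sym eq))
... | tri≈ _ refl _ = refl , +-cancelˡ-≡ (2 * a) _ _ eq

Adjacent : ℕ → ℕ → Set
Adjacent p q = q ≡ suc p ⊎ suc q ≡ p

Adjacent-suc : ∀ {p q} → Adjacent p q → Adjacent (suc p) (suc q)
Adjacent-suc (inj₁ eq) = inj₁ (cong suc eq)
Adjacent-suc (inj₂ eq) = inj₂ (cong suc eq)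

Adjacent-+ˡ : ∀ c {p q} → Adjacent p q → Adjacent (c + p) (c + q)
Adjacent-+ˡ c {p} (inj₁ refl) = inj₁ (+-suc c p)
Adjacent-+ˡ c {q = q} (inj₂ refl) = inj₂ (sym (+-suc c q))

distinct-bits-Adjacent : ∀ {s s′} → s < 2 → s′ < 2 → s ≢ s′ → Adjacent s s′
distinct-bits-Adjacent {0} {0} _ _ 0≢0 = ⊥-elim (0≢0 refl)
distinct-bits-Adjacent {0} {1} _ _ _ = inj₁ refl
distinct-bits-Adjacent {1} {0} _ _ _ = inj₂ refl
distinct-bits-Adjacent {1} {1} _ _ 1≢1 = ⊥-elim (1≢1 refl)
distinct-bits-Adjacent {suc (suc _)} (s≤s (s≤s ()))
distinct-bits-Adjacent {_} {suc (suc _)} _ (s≤s (s≤s ()))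

1∸s<2 : ∀ s → 1 ∸ s < 2
1∸s<2 s = s≤s (m∸n≤m 1 s)

1∸s≢s : ∀ {s} → s < 2 → 1 ∸ s ≢ s
1∸s≢s {0} _ ()
1∸s≢s {1} _ ()
1∸s≢s {suc (suc _)} (s≤s (s≤s ()))

Adjacent-1∸ : ∀ {s} → s < 2 → Adjacent s (1 ∸ s)
Adjacent-1∸ {0} _ = inj₁ refl
Adjacent-1∸ {1} _ = inj₂ refl
Adjacent-1∸ {suc (suc _)} (s≤s (s≤s ()))

∣-∣<2⇒≡⊎Adjacent : ∀ x y → ∣ x - y ∣ < 2 → x ≡ y ⊎ Adjacent x y
∣-∣<2⇒≡⊎Adjacent zero zero _ = inj₁ refl
∣-∣<2⇒≡⊎Adjacent zero (suc zero) _ = inj₂ (inj₁ refl)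
∣-∣<2⇒≡⊎Adjacent zero (suc (suc y)) (s≤s (s≤s ()))
∣-∣<2⇒≡⊎Adjacent (suc zero) zero _ = inj₂ (inj₂ refl)
∣-∣<2⇒≡⊎Adjacent (suc (suc x)) zero (s≤s (s≤s ()))
∣-∣<2⇒≡⊎Adjacent (suc x) (suc y) d<2 with ∣-∣<2⇒≡⊎Adjacent x y d<2
... | inj₁ refl = inj₁ refl
... | inj₂ p~q = inj₂ (Adjacent-suc p~q)

∣n-1+n∣≡1 : ∀ n → ∣ n - suc n ∣ ≡ 1
∣n-1+n∣≡1 zero = refl
∣n-1+n∣≡1 (suc n) = ∣n-1+n∣≡1 n

∣-∣-Adjacent : ∀ {p q} → Adjacent p q → ∣ p - q ∣ ≡ 1
∣-∣-Adjacent {p} (inj₁ refl) = ∣n-1+n∣≡1 p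
∣-∣-Adjacent {q = q} (inj₂ refl) = trans (∣-∣-comm (suc q) q) (∣n-1+n∣≡1 q)

∣p-Q∣≢∣p-1+Q∣ : ∀ p Q → ∣ p - Q ∣ ≢ ∣ p - suc Q ∣
∣p-Q∣≢∣p-1+Q∣ zero Q = <⇒≢ (n<1+n Q)
∣p-Q∣≢∣p-1+Q∣ (suc p) zero eq = <⇒≢ (n<1+n p) (sym (trans eq (∣-∣-identityʳ p)))
∣p-Q∣≢∣p-1+Q∣ (suc p) (suc Q) = ∣p-Q∣≢∣p-1+Q∣ p Q

∣-∣≢∣-∣-Adjacent : ∀ p {Q Q′} → Adjacent Q Q′ → ∣ p - Q ∣ ≢ ∣ p - Q′ ∣
∣-∣≢∣-∣-Adjacent p {Q} (inj₁ refl) = ∣p-Q∣≢∣p-1+Q∣ p Q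
∣-∣≢∣-∣-Adjacent p {Q′ = Q′} (inj₂ refl) = ∣p-Q∣≢∣p-1+Q∣ p Q′ ∘ sym

∣1+p-3+[E+s]∣<1+p+[3+E] : ∀ p E {s} → s < 2 →
  ∣ suc p - 3 + (E + s) ∣ < suc p + (3 + E)
∣1+p-3+[E+s]∣<1+p+[3+E] p E {s} s<2 = s≤s (begin
  ∣ p - 2 + (E + s) ∣      ≤⟨ ∣m-n∣≤m⊔n p _ ⟩
  p ⊔ (2 + (E + s))        ≤⟨ m⊔n≤m+n p _ ⟩
  p + (2 + (E + s))        ≤⟨ +-monoʳ-≤ p (+-monoʳ-≤ 2 (+-monoʳ-≤ E (≤-pred s<2))) ⟩
  p + (2 + (E + 1))        ≡⟨ cong (λ x → p + (2 + x)) (+-comm E 1) ⟩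
  p + (3 + E)              ∎)
  where open ≤-Reasoning

module LegColouring where

  tone : Bool → ℕ
  tone false = 1
  tone true = 2

  tone≢0 : ∀ a → tone a ≢ 0
  tone≢0 false ()
  tone≢0 true ()

  tone≢tone-not : ∀ a → tone a ≢ tone (not a)
  tone≢tone-not false ()
  tone≢tone-not true ()

  tone-injective : ∀ {a a′} → tone a ≡ tone a′ → a ≡ a′
  tone-injective {false} {false} _ = refl
  tone-injective {true} {true} _ = refl

  tone<3 : ∀ a → tone a < 3
  tone<3 false = s≤s (s≤s z≤n)
  tone<3 true = ≤-refl

  odd : ℕ → Bool
  odd zero = false
  odd (suc p) = not (odd p)

  baseColour : Bool → Bool → ℕ → ℕ
  baseColour a x p = if odd p then tone a else if x then tone (not a) else 0

  baseColour<3 : ∀ a x p → baseColour a x p < 3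
  baseColour<3 a x p with odd p | x
  ... | true | _ = tone<3 a
  ... | false | true = tone<3 (not a)
  ... | false | false = s≤s z≤n

  baseColour≢3+ : ∀ a x p e → baseColour a x p ≢ 3 + e
  baseColour≢3+ a x p e eq = <⇒≱ (baseColour<3 a x p) (≤-trans (m≤m+n 3 e) (≤-reflexive (sym eq)))

  baseColour-alternates : ∀ a x p → baseColour a x p ≢ baseColour a x (suc p)
  baseColour-alternates a x p with odd p | x
  ... | true | true = tone≢tone-not a
  ... | true | false = tone≢0 a
  ... | false | true = tone≢tone-not a ∘ sym
  ... | false | false = tone≢0 a ∘ sym

  baseColour-twoTone≢0 : ∀ a p → baseColour a true p ≢ 0
  baseColour-twoTone≢0 a p with odd p
  ... | true = tone≢0 a
  ... | false = tone≢0 (not a)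

  baseColour-hubTone≢tone-not : ∀ a p → baseColour a false p ≢ tone (not a)
  baseColour-hubTone≢tone-not a p with odd p
  ... | true = tone≢tone-not a
  ... | false = tone≢0 (not a) ∘ sym

  baseColour-twoTone-shift : ∀ a p → baseColour (not a) true p ≡ baseColour a true (suc p)
  baseColour-twoTone-shift false p with odd p
  ... | true = refl
  ... | false = refl
  baseColour-twoTone-shift true p with odd p
  ... | true = refl
  ... | false = refl

  baseColour-period2 : ∀ a x p → baseColour a x (suc (suc p)) ≡ baseColour a x p
  baseColour-period2 a x p with odd p
  ... | true = refl
  ... | false = refl

  markDepth : ∀ {t} → (Fin t → Fin 3) → Fin t → ℕ
  markDepth σ e = 3 + (2 * toℕ e + toℕ (σ e))

  MarkedAt : ∀ {t} → (Fin t → Fin 3) → ℕ → Fin t → Set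
  MarkedAt σ p e = toℕ (σ e) < 2 × p ≡ markDepth σ e

  markedAt? : ∀ {t} (σ : Fin t → Fin 3) p e → Dec (MarkedAt σ p e)
  markedAt? σ p e = (toℕ (σ e) <? 2) ×-dec (p ≟ markDepth σ e)

  markedAt-unique : ∀ {t} {σ : Fin t → Fin 3} {p e e′} → MarkedAt σ p e → MarkedAt σ p e′ → e ≡ e′
  markedAt-unique (σe<2 , refl) (σe′<2 , eq) =
    toℕ-injective (proj₁ (2*+-injective σe<2 σe′<2 (suc-injective (suc-injective (suc-injective eq)))))

  marked? : ∀ {t} (σ : Fin t → Fin 3) p → Dec (∃ (MarkedAt σ p))
  marked? σ p = any? (markedAt? σ p)

  legColour : ∀ {t} → Bool → Bool → (Fin t → Fin 3) → ℕ → ℕ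
  legColour a x σ p with marked? σ p
  ... | yes (e , _) = 3 + toℕ e
  ... | no _ = baseColour a x p

  module _ {t} (a x : Bool) (σ : Fin t → Fin 3) where

    legColour-marked : ∀ {p e} → MarkedAt σ p e → legColour a x σ p ≡ 3 + toℕ e
    legColour-marked {p} marked with marked? σ p
    ... | yes (e′ , marked′) = cong (λ f → 3 + toℕ f) (markedAt-unique marked′ marked)
    ... | no unmarked = ⊥-elim (unmarked (_ , marked))

    legColour-unmarked : ∀ {p} → (∀ e → ¬ MarkedAt σ p e) → legColour a x σ p ≡ baseColour a x p
    legColour-unmarked {p} unmarked with marked? σ p
    ... | yes (e , marked) = ⊥-elim (unmarked e marked)
    ... | no _ = refl

    legColour≡3+⇒marked : ∀ {p e} → legColour a x σ p ≡ 3 + toℕ e → MarkedAt σ p e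
    legColour≡3+⇒marked {p} {e} eq with marked? σ p
    ... | yes (e′ , marked) = subst (MarkedAt σ p) (toℕ-injective (+-cancelˡ-≡ 3 _ _ eq)) marked
    ... | no _ = ⊥-elim (baseColour≢3+ a x p (toℕ e) eq)

    legColour<t+3 : ∀ p → legColour a x σ p < t + 3
    legColour<t+3 p with marked? σ p
    ... | yes (e , _) = subst (3 + toℕ e <_) (+-comm 3 t) (+-monoʳ-< 3 (toℕ<n e))
    ... | no _ = ≤-trans (baseColour<3 a x p) (m≤n+m 3 t)

    legColour-alternates : ∀ p → legColour a x σ p ≢ legColour a x σ (suc p)
    legColour-alternates p
      with marked? σ p | marked? σ (suc p)
    ... | yes (e , _ , p≡) | yes (e′ , _ , 1+p≡) = λ eq →
      <⇒≢ (n<1+n p) (trans p≡ (trans (cong (markDepth σ) (toℕ-injective (+-cancelˡ-≡ 3 _ _ eq))) (sym 1+p≡)))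
    ... | yes (e , _) | no _ = baseColour≢3+ a x (suc p) (toℕ e) ∘ sym
    ... | no _ | yes (e′ , _) = baseColour≢3+ a x p (toℕ e′)
    ... | no _ | no _ = baseColour-alternates a x p

    unmarked-shallow : ∀ {p} → p < 3 → ∀ e → ¬ MarkedAt σ p e
    unmarked-shallow p<3 e (_ , refl) = <⇒≱ p<3 (m≤m+n 3 _)

    legColour-depth1 : legColour a x σ 1 ≡ tone a
    legColour-depth1 = legColour-unmarked (unmarked-shallow (s≤s (s≤s z≤n)))

    legColour-depth2 : legColour a x σ 2 ≡ (if x then tone (not a) else 0)
    legColour-depth2 = legColour-unmarked (unmarked-shallow ≤-refl)

    legColour-unused : ∀ {e} → toℕ (σ e) ≡ 2 → ∀ p → legColour a x σ p ≢ 3 + toℕ e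
    legColour-unused σe≡2 p eq = <⇒≢ (proj₁ (legColour≡3+⇒marked eq)) σe≡2

  legColour-twoTone≢0 : ∀ {t} a (σ : Fin t → Fin 3) p → legColour a true σ p ≢ 0
  legColour-twoTone≢0 a σ p with marked? σ p
  ... | yes _ = λ ()
  ... | no _ = baseColour-twoTone≢0 a p

  legColour-hubTone≢tone-not : ∀ {t} a (σ : Fin t → Fin 3) p → legColour a false σ p ≢ tone (not a)
  legColour-hubTone≢tone-not a σ p with marked? σ p
  ... | yes (e , _) = λ eq → baseColour≢3+ a true 2 (toℕ e) (sym eq)
  ... | no _ = baseColour-hubTone≢tone-not a p

  legColour≡0⇒hubTone : ∀ {t} a x (σ : Fin t → Fin 3) p → legColour a x σ p ≡ 0 → x ≡ false
  legColour≡0⇒hubTone a true σ p eq = ⊥-elim (legColour-twoTone≢0 a σ p eq)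
  legColour≡0⇒hubTone a false σ p eq = refl

  twoTone-opposite-marked : ∀ {t} a (σ σ′ : Fin t → Fin 3) p →
    legColour a true σ p ≡ legColour (not a) true σ′ p → ∃[ e ] MarkedAt σ p e
  twoTone-opposite-marked a σ σ′ p same with marked? σ p
  ... | yes marked = marked
  ... | no _ with marked? σ′ p
  ...   | yes (e′ , _) = ⊥-elim (baseColour≢3+ a true p (toℕ e′) same)
  ...   | no _ = ⊥-elim (baseColour-alternates a true p (trans same (baseColour-twoTone-shift a p)))

  otherSlot : ∀ {t} → (Fin t → Fin 3) → Fin t → ℕ
  otherSlot σ e = 3 + (2 * toℕ e + (1 ∸ toℕ (σ e)))

  otherSlot-unmarked : ∀ {t} (σ : Fin t → Fin 3) e → toℕ (σ e) < 2 → ∀ e′ → ¬ MarkedAt σ (otherSlot σ e) e′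
  otherSlot-unmarked σ e σe<2 e′ (σe′<2 , eq)
    with 2*+-injective (1∸s<2 (toℕ (σ e))) σe′<2 (suc-injective (suc-injective (suc-injective eq)))
  ... | e≡e′ , 1∸s≡s′ with toℕ-injective {i = e} {j = e′} e≡e′
  ...   | refl = 1∸s≢s σe<2 1∸s≡s′

  otherSlot-adjacent : ∀ {t} (σ : Fin t → Fin 3) {p e} → MarkedAt σ p e → Adjacent p (otherSlot σ e)
  otherSlot-adjacent σ {e = e} (σe<2 , refl) = Adjacent-+ˡ (3 + 2 * toℕ e) (Adjacent-1∸ σe<2)

  baseColour-twoTone-adjacent : ∀ a {p q} → Adjacent p q → baseColour a true p ≢ baseColour a true q
  baseColour-twoTone-adjacent a {p} (inj₁ refl) = baseColour-alternates a true p
  baseColour-twoTone-adjacent a {q = q} (inj₂ refl) = baseColour-alternates a true q ∘ sym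

  baseColour-twoTone-across : ∀ a {p q} → Adjacent p q → baseColour a true (suc q) ≡ baseColour a true p
  baseColour-twoTone-across a {p} (inj₁ refl) = baseColour-period2 a true p
  baseColour-twoTone-across a (inj₂ refl) = refl

  twoTone-opposite-adjacent : ∀ {t} a (σ : Fin t → Fin 3) {p q Q} → Adjacent p q → Adjacent p Q →
    legColour (not a) true σ q ≢ baseColour a true Q
  twoTone-opposite-adjacent a σ {p} {q} {Q} p~q p~Q with marked? σ q
  ... | yes (e , _) = λ eq → baseColour≢3+ a true Q (toℕ e) (sym eq)
  ... | no _ = λ eq → baseColour-twoTone-adjacent a p~Q (begin
    baseColour a true p            ≡⟨ baseColour-twoTone-across a p~q ⟨
    baseColour a true (suc q)      ≡⟨ baseColour-twoTone-shift a q ⟨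
    baseColour (not a) true q      ≡⟨ eq ⟩
    baseColour a true Q            ∎)
    where open ≡-Reasoning

funToFin-cong : ∀ {m r} {f f′ : Fin m → Fin r} → (∀ e → f e ≡ f′ e) → funToFin f ≡ funToFin f′
funToFin-cong {zero} _ = refl
funToFin-cong {suc m} f≗f′ = cong₂ combine (f≗f′ fzero) (funToFin-cong (f≗f′ ∘ fsuc))

toℕ-remainder-small : ∀ {q} (i : Fin (q * 4)) → toℕ i < 4 → toℕ (remainder {q} 4 i) ≡ toℕ i
toℕ-remainder-small {q} i i<4 = small (toℕ (quotient {q} 4 i)) (toℕ (remainder {q} 4 i)) i≡4d+r
  where
    i≡4d+r : 4 * toℕ (quotient {q} 4 i) + toℕ (remainder {q} 4 i) ≡ toℕ i
    i≡4d+r = trans (sym (toℕ-combine (quotient {q} 4 i) (remainder {q} 4 i))) (cong toℕ (combine-remQuot {q} 4 i))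
    small : ∀ d r → 4 * d + r ≡ toℕ i → r ≡ toℕ i
    small zero r eq = eq
    small (suc d) r eq = ⊥-elim (<⇒≱ i<4 (begin
      4              ≤⟨ m≤m+n 4 (4 * d) ⟩
      4 + 4 * d      ≡⟨ *-suc 4 d ⟨
      4 * suc d      ≤⟨ m≤m+n _ r ⟩
      4 * suc d + r  ≡⟨ eq ⟩
      toℕ i          ∎))
      where open ≤-Reasoning

tag : Bool → Bool → Fin 4
tag false false = 0F
tag true false = 1F
tag false true = 2F
tag true true = 3F

tagFirst tagTwoTone : Fin 4 → Bool
tagFirst 0F = false
tagFirst 1F = true
tagFirst 2F = false
tagFirst 3F = true
tagTwoTone 0F = false
tagTwoTone 1F = false
tagTwoTone 2F = true
tagTwoTone 3F = true

tag-untag : ∀ r → tag (tagFirst r) (tagTwoTone r) ≡ r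
tag-untag 0F = refl
tag-untag 1F = refl
tag-untag 2F = refl
tag-untag 3F = refl

-- Leg i is labelled through i = 4 d + r: the tag r encodes (first, twoTone), the base-3 digits of d the marks.
module Labels (n t : ℕ) (n≤3^t*4 : n ≤ 3 ^ t * 4) (2≤n : 2 ≤ n) where

  position : Fin n → Fin (3 ^ t * 4)
  position i = inject≤ i n≤3^t*4

  digitsOf : Fin n → Fin (3 ^ t)
  digitsOf i = quotient {3 ^ t} 4 (position i)

  tagOf : Fin n → Fin 4
  tagOf i = remainder {3 ^ t} 4 (position i)

  first twoTone : Fin n → Bool
  first i = tagFirst (tagOf i)
  twoTone i = tagTwoTone (tagOf i)

  marks : Fin n → Fin t → Fin 3
  marks i = finToFun (digitsOf i)

  label-injective : ∀ {i i′} → first i ≡ first i′ → twoTone i ≡ twoTone i′ →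
    (∀ e → marks i e ≡ marks i′ e) → i ≡ i′
  label-injective {i} {i′} first≡ twoTone≡ marks≡ =
    toℕ-injective (trans (sym (toℕ-inject≤ i n≤3^t*4)) (trans (cong toℕ position≡) (toℕ-inject≤ i′ n≤3^t*4)))
    where
      open ≡-Reasoning
      digits≡ : digitsOf i ≡ digitsOf i′
      digits≡ = trans (sym (funToFin-finToFin {t} {3} (digitsOf i)))
                      (trans (funToFin-cong marks≡) (funToFin-finToFin {t} {3} (digitsOf i′)))
      tag≡ : tagOf i ≡ tagOf i′
      tag≡ = trans (sym (tag-untag (tagOf i))) (trans (cong₂ tag first≡ twoTone≡) (tag-untag (tagOf i′)))
      position≡ : position i ≡ position i′
      position≡ = begin
        position i                          ≡⟨ combine-remQuot {3 ^ t} 4 (position i) ⟨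
        combine (digitsOf i) (tagOf i)      ≡⟨ cong₂ combine digits≡ tag≡ ⟩
        combine (digitsOf i′) (tagOf i′)    ≡⟨ combine-remQuot {3 ^ t} 4 (position i′) ⟩
        position i′                         ∎

  legWithFirst : Bool → Fin n
  legWithFirst false = fromℕ< {0} (≤-trans (s≤s z≤n) 2≤n)
  legWithFirst true = fromℕ< {1} 2≤n

  first-legWithFirst : ∀ b → first (legWithFirst b) ≡ b
  first-legWithFirst b =
    trans (cong tagFirst (toℕ-injective (trans (toℕ-remainder-small {3 ^ t} (position ℓ) ℓ<4) ℓ≡tag))) (tagFirst-tag b)
    where
      ℓ = legWithFirst b
      tagFirst-tag : ∀ b → tagFirst (tag b false) ≡ b
      tagFirst-tag false = refl
      tagFirst-tag true = refl
      toℕ-legWithFirst : ∀ b → toℕ (legWithFirst b) ≡ toℕ (tag b false)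
      toℕ-legWithFirst false = toℕ-fromℕ< _
      toℕ-legWithFirst true = toℕ-fromℕ< _
      ℓ≡tag : toℕ (position ℓ) ≡ toℕ (tag b false)
      ℓ≡tag = trans (toℕ-inject≤ ℓ n≤3^t*4) (toℕ-legWithFirst b)
      ℓ<4 : toℕ (position ℓ) < 4
      ℓ<4 = subst (_< 4) (sym ℓ≡tag) (toℕ<n (tag b false))

module UpperBound (n k t : ℕ) (n≤3^t*4 : n ≤ 3 ^ t * 4) (2≤n : 2 ≤ n) (2t+4≤k : 2 * t + 4 ≤ k) where

  open Star n k
  open LegColouring
  open Labels n t n≤3^t*4 2≤n

  depth : Fin k → ℕ
  depth j = suc (toℕ j)

  colourOnLeg : Fin n → ℕ → ℕ
  colourOnLeg i = legColour (first i) (twoTone i) (marks i)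

  colourOnLeg≡3+⇒marked : ∀ i {p e} → colourOnLeg i p ≡ 3 + toℕ e → MarkedAt (marks i) p e
  colourOnLeg≡3+⇒marked i = legColour≡3+⇒marked (first i) (twoTone i) (marks i)

  colour : V → ℕ
  colour hub = 0
  colour (leg i j) = colourOnLeg i (depth j)

  colour<t+3 : ∀ v → colour v < t + 3
  colour<t+3 hub = ≤-trans (s≤s z≤n) (m≤n+m 3 t)
  colour<t+3 (leg i j) = legColour<t+3 (first i) (twoTone i) (marks i) (depth j)

  c : V → Fin (t + 3)
  c v = fromℕ< (colour<t+3 v)

  c≡⇒colour≡ : ∀ v w → c v ≡ c w → colour v ≡ colour w
  c≡⇒colour≡ v w eq = trans (sym (toℕ-fromℕ< (colour<t+3 v))) (trans (cong toℕ eq) (toℕ-fromℕ< (colour<t+3 w)))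

  colour≡⇒c≡ : ∀ v w → colour v ≡ colour w → c v ≡ c w
  colour≡⇒c≡ v w eq = toℕ-injective (trans (toℕ-fromℕ< (colour<t+3 v)) (trans eq (sym (toℕ-fromℕ< (colour<t+3 w)))))

  proper : Proper Adj c
  proper u v u~v cu≡cv = colour-edge u~v (c≡⇒colour≡ u v cu≡cv)
    where
      colour-sedge : ∀ {x y} → SEdge n k x y → colour x ≢ colour y
      colour-sedge (hub-leg i j j≡0) eq rewrite j≡0 =
        tone≢0 (first i) (trans (sym (legColour-depth1 (first i) (twoTone i) (marks i))) (sym eq))
      colour-sedge (leg-leg i j j′ j′≡1+j) eq rewrite j′≡1+j =
        legColour-alternates (first i) (twoTone i) (marks i) (depth j) eq
      colour-edge : ∀ {x y} → Adj x y → colour x ≢ colour y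
      colour-edge (inj₁ e) = colour-sedge e
      colour-edge (inj₂ e) = colour-sedge e ∘ sym

  open Colouring c

  distinguished-by-gap′ : ∀ {u v} w {X U L} → colour w ≡ X → dist u w ≤ U →
    (∀ z → colour z ≡ X → L ≤ dist v z) → U < L → Distinguished u v
  distinguished-by-gap′ w cw du far =
    distinguished-by-gap {w = w} refl du (λ z cz → far z (trans (c≡⇒colour≡ z w cz) cw))

  distToClass-exact : ∀ {u} w {X D} → colour w ≡ X → dist u w ≡ D →
    (∀ z → colour z ≡ X → D ≤ dist u z) → distToClass u (c w) ≡ D
  distToClass-exact w cw du≡D far = ≤-antisym
    (≤-trans (distToClass≤dist {w = w} refl) (≤-reflexive du≡D))
    (≤distToClass {w = w} refl λ z cz → far z (trans (c≡⇒colour≡ z w cz) cw))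

  at : Fin n → (d : ℕ) → d < k → V
  at i d d<k = leg i (fromℕ< d<k)

  colour-at : ∀ i d (d<k : d < k) → colour (at i d d<k) ≡ colourOnLeg i (suc d)
  colour-at i d d<k = cong (colourOnLeg i ∘ suc) (toℕ-fromℕ< d<k)

  dist-at : ∀ i j d (d<k : d < k) → dist (leg i j) (at i d d<k) ≡ ∣ toℕ j - d ∣
  dist-at i j d d<k = trans (dist-sameLeg i j _) (cong (λ x → ∣ toℕ j - x ∣) (toℕ-fromℕ< d<k))

  1<k : 1 < k
  1<k = ≤-trans (s≤s (s≤s z≤n)) (≤-trans (m≤n+m 4 (2 * t)) 2t+4≤k)

  0<k : 0 < k
  0<k = <-trans (s≤s z≤n) 1<k

  2+2e+s<k : ∀ (e : Fin t) {s} → s < 2 → 2 + (2 * toℕ e + s) < k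
  2+2e+s<k e {s} s<2 = begin-strict
    2 + (2 * toℕ e + s)   <⟨ +-monoʳ-< 2 (+-monoʳ-< (2 * toℕ e) s<2) ⟩
    2 + (2 * toℕ e + 2)   ≡⟨ cong (2 +_) (trans (+-comm (2 * toℕ e) 2) (sym (*-suc 2 (toℕ e)))) ⟩
    2 + 2 * suc (toℕ e)   ≤⟨ +-monoʳ-≤ 2 (*-monoʳ-≤ 2 (toℕ<n e)) ⟩
    2 + 2 * t             ≤⟨ ≤-trans (≤-reflexive (+-comm 2 (2 * t))) (+-monoʳ-≤ (2 * t) (m≤m+n 2 2)) ⟩
    2 * t + 4             ≤⟨ 2t+4≤k ⟩
    k                     ∎
    where open ≤-Reasoning

  far-from : ∀ i j {X L} → (0 ≡ X → L ≤ depth j) →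
    (∀ {i′} j′ → i ≢ i′ → colourOnLeg i′ (depth j′) ≡ X → L ≤ depth j + depth j′) →
    (∀ j′ → colourOnLeg i (depth j′) ≡ X → L ≤ ∣ toℕ j - toℕ j′ ∣) →
    ∀ z → colour z ≡ X → L ≤ dist (leg i j) z
  far-from i j viaHub viaOther viaOwn hub cz = viaHub cz
  far-from i j viaHub viaOther viaOwn (leg i′ j′) cz with i ≟ᶠ i′
  ... | yes refl = viaOwn j′ cz
  ... | no i≢i′ = viaOther j′ i≢i′ cz

  twoTone-far-from-hubColour : ∀ i j → twoTone i ≡ true → ∀ z → colour z ≡ 0 → depth j ≤ dist (leg i j) z
  twoTone-far-from-hubColour i j twoTone-i = far-from i j (λ _ → ≤-refl) (λ j′ _ _ → m≤m+n (depth j) (depth j′))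
    λ j′ eq → ⊥-elim (legColour-twoTone≢0 (first i) (marks i) (depth j′)
                        (subst (λ x → legColour (first i) x (marks i) (depth j′) ≡ 0) twoTone-i eq))

  hubTone-far-from-toneNot : ∀ i j → twoTone i ≡ false →
    ∀ z → colour z ≡ tone (not (first i)) → suc (depth j) ≤ dist (leg i j) z
  hubTone-far-from-toneNot i j hubTone-i = far-from i j (λ eq → ⊥-elim (tone≢0 _ (sym eq)))
    (λ j′ _ _ → ≤-trans (≤-reflexive (+-comm 1 (depth j))) (+-monoʳ-≤ (depth j) (s≤s z≤n)))
    λ j′ eq → ⊥-elim (legColour-hubTone≢tone-not (first i) (marks i) (depth j′)
                        (subst (λ x → legColour (first i) x (marks i) (depth j′) ≡ tone (not (first i))) hubTone-i eq))

  markDepth≤1+markDepth : ∀ {σ σ′ : Fin t → Fin 3} e → toℕ (σ e) < 2 → markDepth σ e ≤ suc (markDepth σ′ e)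
  markDepth≤1+markDepth {σ} {σ′} e σe<2 =
    ≤-trans (+-monoʳ-≤ 3 (+-monoʳ-≤ (2 * toℕ e) (≤-trans (≤-pred σe<2) (s≤s z≤n))))
            (≤-reflexive (cong (3 +_) (+-suc (2 * toℕ e) (toℕ (σ′ e)))))

  far-from-mark : ∀ i j e → toℕ (marks i e) < 2 →
    ∀ z → colour z ≡ 3 + toℕ e → ∣ depth j - markDepth (marks i) e ∣ ≤ dist (leg i j) z
  far-from-mark i j e σe<2 = far-from i j (λ ()) viaOther viaOwn
    where
      P = markDepth (marks i) e
      viaOther : ∀ {i′} j′ → i ≢ i′ → colourOnLeg i′ (depth j′) ≡ 3 + toℕ e →
        ∣ depth j - P ∣ ≤ depth j + depth j′
      viaOther {i′} j′ _ eq = ≤-trans (∣m-n∣≤m⊔n (depth j) P) (⊔-lub (m≤m+n (depth j) (depth j′)) (begin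
        P                             ≤⟨ markDepth≤1+markDepth {marks i} {marks i′} e σe<2 ⟩
        suc (markDepth (marks i′) e)  ≡⟨ cong suc (proj₂ (colourOnLeg≡3+⇒marked i′ eq)) ⟨
        1 + depth j′                  ≤⟨ +-monoˡ-≤ (depth j′) (s≤s z≤n) ⟩
        depth j + depth j′            ∎))
        where open ≤-Reasoning
      viaOwn : ∀ j′ → colourOnLeg i (depth j′) ≡ 3 + toℕ e → ∣ depth j - P ∣ ≤ ∣ toℕ j - toℕ j′ ∣
      viaOwn j′ eq = ≤-reflexive (cong (λ x → ∣ depth j - x ∣) (sym (proj₂ (colourOnLeg≡3+⇒marked i eq))))

  far-from-unusedMark : ∀ i j e → toℕ (marks i e) ≡ 2 →
    ∀ z → colour z ≡ 3 + toℕ e → depth j + (3 + 2 * toℕ e) ≤ dist (leg i j) z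
  far-from-unusedMark i j e σe≡2 = far-from i j (λ ())
    (λ {i′} j′ _ eq → +-monoʳ-≤ (depth j) (≤-trans (+-monoʳ-≤ 3 (m≤m+n (2 * toℕ e) _))
      (≤-reflexive (sym (proj₂ (colourOnLeg≡3+⇒marked i′ eq))))))
    (λ j′ eq → ⊥-elim (legColour-unused (first i) (twoTone i) (marks i) σe≡2 (depth j′) eq))

  toneVertex : Bool → V
  toneVertex b = at (legWithFirst b) 0 0<k

  colour-toneVertex : ∀ b → colour (toneVertex b) ≡ tone b
  colour-toneVertex b = begin
    colour (toneVertex b)       ≡⟨ colour-at ℓ 0 0<k ⟩
    colourOnLeg ℓ 1             ≡⟨ legColour-depth1 (first ℓ) (twoTone ℓ) (marks ℓ) ⟩
    tone (first ℓ)              ≡⟨ cong tone (first-legWithFirst b) ⟩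
    tone b                      ∎
    where
      open ≡-Reasoning
      ℓ = legWithFirst b

  dist-toneVertex : ∀ i j b → dist (leg i j) (toneVertex b) ≤ suc (depth j)
  dist-toneVertex i j b = ≤-trans (dist-triangle (leg i j) hub (toneVertex b))
    (≤-reflexive (trans (cong (depth j +_) (cong suc (toℕ-fromℕ< 0<k))) (+-comm (depth j) 1)))

  sameKind-shallower : ∀ {i i′} j j′ → first i ≡ first i′ → twoTone i ≡ twoTone i′ →
    toℕ j < toℕ j′ → Distinguished (leg i j) (leg i′ j′)
  sameKind-shallower {i} {i′} j j′ first≡ twoTone≡ j<j′ with twoTone i
  ... | true = distinguished-by-gap′ hub refl ≤-refl
                 (twoTone-far-from-hubColour i′ j′ (sym twoTone≡)) (s≤s j<j′)
  ... | false = distinguished-by-gap′ (toneVertex (not (first i))) (colour-toneVertex (not (first i)))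
                  (dist-toneVertex i j (not (first i))) far (s≤s (s≤s j<j′))
    where
      far : ∀ z → colour z ≡ tone (not (first i)) → suc (depth j′) ≤ dist (leg i′ j′) z
      far z cz = hubTone-far-from-toneNot i′ j′ (sym twoTone≡) z (trans cz (cong (tone ∘ not) first≡))

  markVertex : ∀ i e → toℕ (marks i e) < 2 → V
  markVertex i e σe<2 = at i (2 + (2 * toℕ e + toℕ (marks i e))) (2+2e+s<k e σe<2)

  colour-markVertex : ∀ i e σe<2 → colour (markVertex i e σe<2) ≡ 3 + toℕ e
  colour-markVertex i e σe<2 =
    trans (colour-at i _ (2+2e+s<k e σe<2)) (legColour-marked (first i) (twoTone i) (marks i) (σe<2 , refl))

  distToClass-markColour : ∀ i e σe<2 j →
    distToClass (leg i j) (c (markVertex i e σe<2)) ≡ ∣ depth j - markDepth (marks i) e ∣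
  distToClass-markColour i e σe<2 j = distToClass-exact (markVertex i e σe<2) (colour-markVertex i e σe<2)
    (dist-at i j _ (2+2e+s<k e σe<2)) (far-from-mark i j e σe<2)

  differentlyMarked : ∀ {i i′} j j′ e (σe<2 : toℕ (marks i e) < 2) (σ′e<2 : toℕ (marks i′ e) < 2) →
    toℕ (marks i e) ≢ toℕ (marks i′ e) → toℕ j ≡ toℕ j′ → Distinguished (leg i j) (leg i′ j′)
  differentlyMarked {i} {i′} j j′ e σe<2 σ′e<2 differ j≡j′ =
    distinguished-by-distToClass {w = markVertex i e σe<2} refl λ eq →
      ∣-∣≢∣-∣-Adjacent (depth j) (Adjacent-+ˡ (3 + 2 * toℕ e) (distinct-bits-Adjacent σe<2 σ′e<2 differ)) (begin
        ∣ depth j - markDepth (marks i) e ∣                   ≡⟨ distToClass-markColour i e σe<2 j ⟨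
        distToClass (leg i j) (c (markVertex i e σe<2))       ≡⟨ eq ⟩
        distToClass (leg i′ j′) (c (markVertex i e σe<2))     ≡⟨ cong (distToClass (leg i′ j′)) same-class ⟨
        distToClass (leg i′ j′) (c (markVertex i′ e σ′e<2))   ≡⟨ distToClass-markColour i′ e σ′e<2 j′ ⟩
        ∣ depth j′ - markDepth (marks i′) e ∣                 ≡⟨ cong (λ p → ∣ suc p - markDepth (marks i′) e ∣) j≡j′ ⟨
        ∣ depth j - markDepth (marks i′) e ∣                  ∎)
    where
      open ≡-Reasoning
      same-class : c (markVertex i′ e σ′e<2) ≡ c (markVertex i e σe<2)
      same-class = colour≡⇒c≡ _ _ (trans (colour-markVertex i′ e σ′e<2) (sym (colour-markVertex i e σe<2)))

  markedVsUnused : ∀ {i i′} j j′ e (σe<2 : toℕ (marks i e) < 2) → toℕ (marks i′ e) ≡ 2 →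
    toℕ j ≡ toℕ j′ → Distinguished (leg i j) (leg i′ j′)
  markedVsUnused {i} {i′} j j′ e σe<2 σ′e≡2 j≡j′ =
    distinguished-by-gap′ (markVertex i e σe<2) (colour-markVertex i e σe<2)
      (≤-reflexive (dist-at i j _ (2+2e+s<k e σe<2))) (far-from-unusedMark i′ j′ e σ′e≡2)
      (subst (λ p → ∣ depth j - markDepth (marks i) e ∣ < suc p + (3 + 2 * toℕ e)) j≡j′
        (∣1+p-3+[E+s]∣<1+p+[3+E] (toℕ j) (2 * toℕ e) σe<2))

  markOrUnused : ∀ (s : Fin 3) → toℕ s < 2 ⊎ toℕ s ≡ 2
  markOrUnused 0F = inj₁ (s≤s z≤n)
  markOrUnused 1F = inj₁ (s≤s (s≤s z≤n))
  markOrUnused 2F = inj₂ refl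

  sameKind-sameDepth : ∀ {i i′} j j′ → first i ≡ first i′ → twoTone i ≡ twoTone i′ → i ≢ i′ →
    toℕ j ≡ toℕ j′ → Distinguished (leg i j) (leg i′ j′)
  sameKind-sameDepth {i} {i′} j j′ first≡ twoTone≡ i≢i′ j≡j′
    with ¬∀⟶∃¬ t _ (λ e → marks i e ≟ᶠ marks i′ e) (i≢i′ ∘ label-injective first≡ twoTone≡)
  ... | e , differ with markOrUnused (marks i e) | markOrUnused (marks i′ e)
  ...   | inj₁ σe<2 | inj₁ σ′e<2 = differentlyMarked j j′ e σe<2 σ′e<2 (differ ∘ toℕ-injective) j≡j′
  ...   | inj₁ σe<2 | inj₂ σ′e≡2 = markedVsUnused j j′ e σe<2 σ′e≡2 j≡j′
  ...   | inj₂ σe≡2 | inj₁ σ′e<2 = distinguished-sym (markedVsUnused j′ j e σ′e<2 σe≡2 (sym j≡j′))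
  ...   | inj₂ σe≡2 | inj₂ σ′e≡2 = ⊥-elim (differ (toℕ-injective (trans σe≡2 (sym σ′e≡2))))

  sameKind : ∀ {i i′} j j′ → first i ≡ first i′ → twoTone i ≡ twoTone i′ → leg i j ≢ leg i′ j′ →
    Distinguished (leg i j) (leg i′ j′)
  sameKind {i} {i′} j j′ first≡ twoTone≡ distinct with <-cmp (toℕ j) (toℕ j′)
  ... | tri< j<j′ _ _ = sameKind-shallower j j′ first≡ twoTone≡ j<j′
  ... | tri> _ _ j′<j = distinguished-sym (sameKind-shallower j′ j (sym first≡) (sym twoTone≡) j′<j)
  ... | tri≈ _ j≡j′ _ with i ≟ᶠ i′
  ...   | yes refl = ⊥-elim (distinct (cong (leg i) (toℕ-injective j≡j′)))
  ...   | no i≢i′ = sameKind-sameDepth j j′ first≡ twoTone≡ i≢i′ j≡j′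

  colour-depth1 : ∀ i j → toℕ j ≡ 0 → colour (leg i j) ≡ tone (first i)
  colour-depth1 i j j≡0 = trans (cong (colourOnLeg i ∘ suc) j≡0) (legColour-depth1 (first i) (twoTone i) (marks i))

  secondVertex : Fin n → V
  secondVertex i = at i 1 1<k

  colour-secondVertex : ∀ i → colour (secondVertex i) ≡ (if twoTone i then tone (not (first i)) else 0)
  colour-secondVertex i = trans (colour-at i 1 1<k) (legColour-depth2 (first i) (twoTone i) (marks i))

  hubTone-vs-twoTone-sameDepth : ∀ {i i′} j j′ → twoTone i ≡ false → twoTone i′ ≡ true →
    colour (leg i j) ≡ colour (leg i′ j′) → toℕ j ≡ toℕ j′ → Distinguished (leg i j) (leg i′ j′)
  hubTone-vs-twoTone-sameDepth {i} {i′} j j′ hubTone-i twoTone-i′ same j≡j′ = byDepth (toℕ j) refl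
    where
      byDepth : ∀ d → toℕ j ≡ d → Distinguished (leg i j) (leg i′ j′)
      byDepth (suc d) toℕj = distinguished-by-gap′ (secondVertex i)
        (trans (colour-secondVertex i) (cong (λ x → if x then tone (not (first i)) else 0) hubTone-i))
        (≤-reflexive (trans (dist-at i j 1 1<k) (trans (cong (λ x → ∣ x - 1 ∣) toℕj) (∣-∣-identityʳ d))))
        (twoTone-far-from-hubColour i′ j′ twoTone-i′)
        (subst (λ x → d < suc x) (trans (sym toℕj) j≡j′) (<-trans (n<1+n d) (n<1+n (suc d))))
      byDepth zero toℕj = distinguished-sym (distinguished-by-gap′ (secondVertex i′) colour-w dist-w
        (hubTone-far-from-toneNot i j hubTone-i) (s≤s (s≤s z≤n)))
        where
          first≡ : first i′ ≡ first i
          first≡ = tone-injective (trans (sym (colour-depth1 i′ j′ (trans (sym j≡j′) toℕj)))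
                                         (trans (sym same) (colour-depth1 i j toℕj)))
          colour-w : colour (secondVertex i′) ≡ tone (not (first i))
          colour-w = trans (colour-secondVertex i′)
            (trans (cong (λ x → if x then tone (not (first i′)) else 0) twoTone-i′) (cong (tone ∘ not) first≡))
          dist-w : dist (leg i′ j′) (secondVertex i′) ≤ 1
          dist-w = ≤-reflexive (trans (dist-at i′ j′ 1 1<k) (cong (λ x → ∣ x - 1 ∣) (trans (sym j≡j′) toℕj)))

  hubTone-vs-twoTone : ∀ {i i′} j j′ → twoTone i ≡ false → twoTone i′ ≡ true →
    colour (leg i j) ≡ colour (leg i′ j′) → Distinguished (leg i j) (leg i′ j′)
  hubTone-vs-twoTone {i} {i′} j j′ hubTone-i twoTone-i′ same with <-cmp (toℕ j) (toℕ j′)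
  ... | tri< j<j′ _ _ = distinguished-by-gap′ hub refl ≤-refl (twoTone-far-from-hubColour i′ j′ twoTone-i′) (s≤s j<j′)
  ... | tri> _ _ j′<j = distinguished-sym (distinguished-by-gap′ (toneVertex (not (first i)))
          (colour-toneVertex (not (first i))) (dist-toneVertex i′ j′ (not (first i)))
          (hubTone-far-from-toneNot i j hubTone-i) (s≤s (s≤s j′<j)))
  ... | tri≈ _ j≡j′ _ = hubTone-vs-twoTone-sameDepth j j′ hubTone-i twoTone-i′ same j≡j′

  hubTone-vs-hubTone-≤ : ∀ {i i′} j j′ → twoTone i′ ≡ false → first i′ ≡ not (first i) →
    toℕ j ≤ toℕ j′ → Distinguished (leg i j) (leg i′ j′)
  hubTone-vs-hubTone-≤ {i} {i′} j j′ hubTone-i′ first≡ j≤j′ =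
    distinguished-by-gap′ (at i 0 0<k) (colour-depth1 i _ (toℕ-fromℕ< 0<k))
      (≤-reflexive (trans (dist-at i j 0 0<k) (∣-∣-identityʳ (toℕ j))))
      (λ z cz → hubTone-far-from-toneNot i′ j′ hubTone-i′ z
                  (trans cz (cong tone (sym (trans (cong not first≡) (not-involutive (first i)))))))
      (s≤s (m≤n⇒m≤1+n j≤j′))

  hubTone-vs-hubTone : ∀ {i i′} j j′ → twoTone i ≡ false → twoTone i′ ≡ false → first i′ ≡ not (first i) →
    Distinguished (leg i j) (leg i′ j′)
  hubTone-vs-hubTone {i} {i′} j j′ hubTone-i hubTone-i′ first≡ with ≤-total (toℕ j) (toℕ j′)
  ... | inj₁ j≤j′ = hubTone-vs-hubTone-≤ j j′ hubTone-i′ first≡ j≤j′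
  ... | inj₂ j′≤j = distinguished-sym (hubTone-vs-hubTone-≤ j′ j hubTone-i
                      (trans (sym (not-involutive (first i))) (cong not (sym first≡))) j′≤j)

  -- Unmarked vertices at equal depth on two-tone legs with opposite tones differ in colour, so both carry
  -- the extra colour 3 + e. The free slot of mark e on the first leg is then adjacent to the first vertex,
  -- whereas every vertex within distance 1 of the second one avoids the colour of that slot.
  twoTone-opposite-sameDepth : ∀ {i i′} j j′ → twoTone i ≡ true → twoTone i′ ≡ true → first i′ ≡ not (first i) →
    colour (leg i j) ≡ colour (leg i′ j′) → toℕ j ≡ toℕ j′ → Distinguished (leg i j) (leg i′ j′)
  twoTone-opposite-sameDepth {i} {i′} j j′ twoTone-i twoTone-i′ first≡ same j≡j′ =
    distinguished-by-gap′ slot colour-slot (≤-reflexive dist-slot) far (s≤s (s≤s z≤n))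
    where
      a = first i
      p = depth j
      onLeg : ∀ q → colourOnLeg i q ≡ legColour a true (marks i) q
      onLeg q = cong (λ x → legColour a x (marks i) q) twoTone-i
      onLeg′ : ∀ q → colourOnLeg i′ q ≡ legColour (not a) true (marks i′) q
      onLeg′ q = cong₂ (λ a′ x → legColour a′ x (marks i′) q) first≡ twoTone-i′
      marked : ∃[ e ] MarkedAt (marks i) p e
      marked = twoTone-opposite-marked a (marks i) (marks i′) p
        (trans (sym (onLeg p)) (trans same (trans (cong (colourOnLeg i′ ∘ suc) (sym j≡j′)) (onLeg′ p))))
      e = proj₁ marked
      Q = otherSlot (marks i) e
      p~Q : Adjacent p Q
      p~Q = otherSlot-adjacent (marks i) (proj₂ marked)
      slot : V
      slot = at i (2 + (2 * toℕ e + (1 ∸ toℕ (marks i e)))) (2+2e+s<k e (1∸s<2 (toℕ (marks i e))))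
      colour-slot : colour slot ≡ baseColour a true Q
      colour-slot = trans (colour-at i _ (2+2e+s<k e (1∸s<2 (toℕ (marks i e))))) (trans (onLeg Q)
        (legColour-unmarked a true (marks i) (otherSlot-unmarked (marks i) e (proj₁ (proj₂ marked)))))
      dist-slot : dist (leg i j) slot ≡ 1
      dist-slot = trans (dist-at i j _ (2+2e+s<k e (1∸s<2 (toℕ (marks i e))))) (∣-∣-Adjacent p~Q)
      colour-v′ : colourOnLeg i′ (depth j′) ≡ 3 + toℕ e
      colour-v′ = trans (sym same) (trans (onLeg p) (legColour-marked a true (marks i) (proj₂ marked)))
      viaOwn : ∀ j″ → colourOnLeg i′ (depth j″) ≡ baseColour a true Q → 2 ≤ ∣ toℕ j′ - toℕ j″ ∣
      viaOwn j″ eq with 2 ≤? ∣ toℕ j′ - toℕ j″ ∣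
      ... | yes apart = apart
      ... | no near with ∣-∣<2⇒≡⊎Adjacent (toℕ j′) (toℕ j″) (≰⇒> near)
      ...   | inj₁ j′≡j″ = ⊥-elim (baseColour≢3+ a true Q (toℕ e)
                (trans (sym eq) (trans (cong (colourOnLeg i′ ∘ suc) (sym j′≡j″)) colour-v′)))
      ...   | inj₂ j′~j″ = ⊥-elim (twoTone-opposite-adjacent a (marks i′)
                (subst (λ x → Adjacent (suc x) (depth j″)) (sym j≡j′) (Adjacent-suc j′~j″)) p~Q
                (trans (sym (onLeg′ (depth j″))) eq))
      far : ∀ z → colour z ≡ baseColour a true Q → 2 ≤ dist (leg i′ j′) z
      far = far-from i′ j′ (λ eq → ⊥-elim (baseColour-twoTone≢0 a Q (sym eq)))
        (λ j″ _ _ → +-mono-≤ (s≤s z≤n) (s≤s z≤n)) viaOwn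

  twoTone-opposite : ∀ {i i′} j j′ → twoTone i ≡ true → twoTone i′ ≡ true → first i′ ≡ not (first i) →
    colour (leg i j) ≡ colour (leg i′ j′) → Distinguished (leg i j) (leg i′ j′)
  twoTone-opposite {i} {i′} j j′ twoTone-i twoTone-i′ first≡ same with <-cmp (toℕ j) (toℕ j′)
  ... | tri< j<j′ _ _ = distinguished-by-gap′ hub refl ≤-refl (twoTone-far-from-hubColour i′ j′ twoTone-i′) (s≤s j<j′)
  ... | tri> _ _ j′<j = distinguished-sym
          (distinguished-by-gap′ hub refl ≤-refl (twoTone-far-from-hubColour i j twoTone-i) (s≤s j′<j))
  ... | tri≈ _ j≡j′ _ = twoTone-opposite-sameDepth j j′ twoTone-i twoTone-i′ first≡ same j≡j′

  true-or-false : ∀ b → b ≡ true ⊎ b ≡ false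
  true-or-false true = inj₁ refl
  true-or-false false = inj₂ refl

  legs-distinguished : ∀ i j i′ j′ → leg i j ≢ leg i′ j′ → Distinguished (leg i j) (leg i′ j′)
  legs-distinguished i j i′ j′ distinct with colour (leg i j) ≟ colour (leg i′ j′)
  ... | no differ = distinguished-by-colour (differ ∘ c≡⇒colour≡ (leg i j) (leg i′ j′))
  ... | yes same with first i ≟ᵇ first i′ | true-or-false (twoTone i) | true-or-false (twoTone i′)
  ...   | yes first≡ | inj₁ x | inj₁ x′ = sameKind j j′ first≡ (trans x (sym x′)) distinct
  ...   | yes first≡ | inj₂ x | inj₂ x′ = sameKind j j′ first≡ (trans x (sym x′)) distinct
  ...   | _ | inj₂ x | inj₁ x′ = hubTone-vs-twoTone j j′ x x′ same
  ...   | _ | inj₁ x | inj₂ x′ = distinguished-sym (hubTone-vs-twoTone j′ j x′ x (sym same))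
  ...   | no first≢ | inj₂ x | inj₂ x′ = hubTone-vs-hubTone j j′ x x′ (¬-not (first≢ ∘ sym))
  ...   | no first≢ | inj₁ x | inj₁ x′ = twoTone-opposite j j′ x x′ (¬-not (first≢ ∘ sym)) same

  hub-vs-leg : ∀ i j → Distinguished hub (leg i j)
  hub-vs-leg i j with 0 ≟ colour (leg i j)
  ... | no differ = distinguished-by-colour (differ ∘ c≡⇒colour≡ hub (leg i j))
  ... | yes same = distinguished-by-gap′ (toneVertex (not (first i))) (colour-toneVertex (not (first i)))
          (≤-reflexive (cong suc (toℕ-fromℕ< 0<k)))
          (hubTone-far-from-toneNot i j (legColour≡0⇒hubTone (first i) (twoTone i) (marks i) (depth j) (sym same)))
          (s≤s (s≤s z≤n))

  locating : Locating Adj c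
  locating hub hub distinct = ⊥-elim (distinct refl)
  locating hub (leg i j) _ = hub-vs-leg i j
  locating (leg i j) hub _ = distinguished-sym (hub-vs-leg i j)
  locating (leg i j) (leg i′ j′) distinct = legs-distinguished i j i′ j′ distinct

  locatingColouring : LocatingColoring Adj (t + 3)
  locatingColouring = c , proper , locating

4*3^[t+1]<9*n : ∀ n t → 3 ≤ n → (∀ s → s < t → 4 * 3 ^ s < n) → 4 * 3 ^ (t + 1) < 9 * n
4*3^[t+1]<9*n n zero 3≤n _ = ≤-trans (m≤m+n 13 14) (*-monoʳ-≤ 9 3≤n)
4*3^[t+1]<9*n n (suc s) _ minimal = begin-strict
  4 * 3 ^ (suc s + 1)    ≡⟨ cong (λ x → 4 * 3 ^ x) (+-comm (suc s) 1) ⟩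
  4 * (3 * (3 * 3 ^ s))  ≡⟨ solve 1 (λ x → con 4 :* (con 3 :* (con 3 :* x)) := con 9 :* (con 4 :* x)) refl (3 ^ s) ⟩
  9 * (4 * 3 ^ s)        <⟨ *-monoʳ-< 9 (minimal s ≤-refl) ⟩
  9 * n                  ∎
  where
    open ≤-Reasoning
    open +-*-Solver

corollary1 : ∀ (n k t : ℕ) → 3 ≤ n → IsCeilLog3Quarter n t →
    2 * t + 4 ≤ k → LocChromNum (SAdj n k) (t + 3)
corollary1 n zero t _ _ 2t+4≤0 with ≤-trans (m≤n+m 4 (2 * t)) 2t+4≤0
... | ()
corollary1 n (suc k) t 3≤n (n≤4*3^t , minimal) 2t+4≤k =
  UpperBound.locatingColouring n (suc k) t (≤-trans n≤4*3^t (≤-reflexive (*-comm 4 (3 ^ t))))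
    (≤-trans (s≤s (s≤s z≤n)) 3≤n) 2t+4≤k ,
  λ m m<t+3 colouring → <⇒≱ (4*3^[t+1]<9*n n t 3≤n minimal) (begin
    9 * n              ≤⟨ locatingColouring-bound n k m colouring ⟩
    4 * 3 ^ (m ∸ 1)    ≤⟨ *-monoʳ-≤ 4 (^-monoʳ-≤ 3 (m∸1≤t+1 m<t+3)) ⟩
    4 * 3 ^ (t + 1)    ∎)
  where
    open ≤-Reasoning
    m∸1≤t+1 : ∀ {m} → m < t + 3 → m ∸ 1 ≤ t + 1
    m∸1≤t+1 {m} m<t+3 = ≤-trans (∸-monoˡ-≤ 1 (≤-pred (subst (suc m ≤_) (+-suc t 2) m<t+3)))
                                (≤-reflexive (+-∸-assoc t {2} {1} (s≤s z≤n)))
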